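{- Let $F$ be a field of characteristic not $2$, let $f(X)=c_dX^d+\cdots+c_1X\in\mathbb{Z}[X]$, let $n$ be a natural number with $n\le d$, and let $a_1,\ldots,a_d\in F^\ast$. Suppose that $f\bigl(\perp_{i=1}^{k}\langle\!\langle a_{\sigma(i)}\rangle\!\rangle\bigr)=0$ in $W(F)$ for all $1\le k\le n$ and all permutations $\sigma\in S_d$. Then \[\Bigl(\sum_{q=n}^{d}2^{q-n}\,n!\,S(q,n)\,c_q\Bigr)\langle\!\langle a_{\tau(1)},\ldots,a_{\tau(n)}\rangle\!\rangle=0\quad\text{in }W(F)\text{ for all }\tau\in S_d.\]
   Context: $W(F)$ is the Witt ring of nonsingular quadratic forms over $F$; integer multiples and polynomial evaluation $f(\phi)=\sum_i c_i\phi^i$ are taken in this ring (orthogonal sums and tensor products). $\langle\!\langle b_1,\ldots,b_m\rangle\!\rangle=\langle1,b_1\rangle\otimes\cdots\otimes\langle1,b_m\rangle$ is the $m$-fold Pfister form (with the $0$-fold one equal to $\langle1\rangle$). $S_d$ is the symmetric group on $\{1,\ldots,d\}$. $S(q,n)$ is the Stirling number of the second kind, defined by $x^q=\sum_{n\ge0}S(q,n)x(x-1)\cdots(x-n+1)$. -}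

module Defs where

open import Level using (_⊔_) renaming (suc to lsuc)
open import Algebra.Bundles using (CommutativeRing)
open import Data.Nat as ℕ using (ℕ; zero; suc; _∸_; _!)
open import Data.Integer as ℤ using (ℤ; +_; -[1+_])
open import Data.Fin using (Fin; zero; suc; _≟_)
open import Data.List using (List; []; _∷_; _++_; map; concatMap; length; replicate; foldr; upTo; lookup)
open import Data.Bool using (if_then_else_)
open import Data.Product using (Σ; ∃; ∃₂; _×_)
open import Relation.Nullary using (¬_; does)

record Field c ℓ : Set (lsuc (c ⊔ ℓ)) where
  field
    commutativeRing : CommutativeRing c ℓ
  open CommutativeRing commutativeRing public
  field
    1≉0     : ¬ (1# ≈ 0#)
    inverse : ∀ x → ¬ (x ≈ 0#) → ∃ λ y → x * y ≈ 1#

Stirling₂ : ℕ → ℕ → ℕ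
Stirling₂ zero    zero    = 1
Stirling₂ zero    (suc n) = 0
Stirling₂ (suc q) zero    = 0
Stirling₂ (suc q) (suc n) = suc n ℕ.* Stirling₂ q (suc n) ℕ.+ Stirling₂ q n

-- The integer  Σ_{q=n}^{d} 2^{q-n} n! S(q,n) c_q   (q = n + j, j = 0..d-n)
coefficientSum : (ℕ → ℤ) → ℕ → ℕ → ℤ
coefficientSum c n d =
  foldr ℤ._+_ (+ 0)
    (map (λ j → (+ (2 ℕ.^ j ℕ.* (n !) ℕ.* Stirling₂ (n ℕ.+ j) n)) ℤ.* c (n ℕ.+ j))
         (upTo (suc (d ∸ n))))

module Witt {c ℓ} (F : Field c ℓ) where
  open Field F using (Carrier; _≈_; _+_; _*_; -_; 0#; 1#)

  -- diagonal quadratic form ⟨b₁,…,bₘ⟩ (entries are meant to be nonzero)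
  Form : Set c
  Form = List Carrier

  ∑ : (m : ℕ) → (Fin m → Carrier) → Carrier
  ∑ zero    f = 0#
  ∑ (suc m) f = f zero + ∑ m (λ i → f (suc i))

  δ : ∀ {m} → Fin m → Fin m → Carrier
  δ i j = if does (i ≟ j) then 1# else 0#

  -- Isometry of diagonal forms φ, ψ: an invertible linear map M : F^{dim ψ} → F^{dim φ}
  -- with q_φ ∘ M = q_ψ, i.e. Mᵀ diag(φ) M = diag(ψ).
  Isometric : Form → Form → Set (c ⊔ ℓ)
  Isometric φ ψ =
    Σ (Fin (length φ) → Fin (length ψ) → Carrier) λ M →
    Σ (Fin (length ψ) → Fin (length φ) → Carrier) λ N →
      (∀ i i' → ∑ (length ψ) (λ j → M i j * N j i') ≈ δ i i')
    × (∀ j j' → ∑ (length φ) (λ i → N j i * M i j') ≈ δ j j')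
    × (∀ j j' → ∑ (length φ) (λ i → M i j * (lookup φ i * M i j')) ≈ δ j j' * lookup ψ j)

  -- orthogonal sum is _++_
  _⊗_ : Form → Form → Form
  φ ⊗ ψ = concatMap (λ a → map (a *_) ψ) φ

  ⟨1,_⟩ : Carrier → Form
  ⟨1, b ⟩ = 1# ∷ b ∷ []

  hyperbolicPlane : Form
  hyperbolicPlane = 1# ∷ (- 1#) ∷ []

  pfister : List Carrier → Form
  pfister = foldr (λ b acc → ⟨1, b ⟩ ⊗ acc) (1# ∷ [])

  _·_ : ℕ → Form → Form
  m · φ = concatMap (λ _ → φ) (replicate m φ)

  -- additive inverse in W(F): -[φ] = [⟨-1⟩ ⊗ φ]
  negForm : Form → Form
  negForm = map (-_)

  _ℤ·_ : ℤ → Form → Form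
  (+ m)     ℤ· φ = m · φ
  (-[1+ m ]) ℤ· φ = suc m · negForm φ

  _^_ : Form → ℕ → Form
  φ ^ zero  = 1# ∷ []
  φ ^ suc k = φ ⊗ (φ ^ k)

  evalPoly : (ℕ → ℤ) → ℕ → Form → Form
  evalPoly c d φ = concatMap (λ q → c q ℤ· (φ ^ q)) (upTo (suc d))

  IsZeroW : Form → Set (c ⊔ ℓ)
  IsZeroW φ = ∃₂ λ m k → Isometric (φ ++ (m · hyperbolicPlane)) (k · hyperbolicPlane)

-- The 1-fold
-- Pfister forms eᵢ = ⟨⟨aᵢ⟩⟩ satisfy eᵢ² = 2eᵢ because ⟨aᵢ²⟩ ≅ ⟨1⟩, and for any elements of a
-- commutative ring with this property, induction on q gives
--   (Σᵢ eᵢ)^q = Σ_T 2^(q-|T|) |T|! S(q,|T|) e_T,   e_T = Π_{i∈T} eᵢ.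
-- Hence f(Σ_{i∈T} eᵢ) = Σ_{U⊆T} g(|U|) e_U with g(k) = Σ_q 2^(q-k) k! S(q,k) c_q. The hypotheses
-- (every nonempty T is the image of {1..k} under some σ ∈ S_d) together with c₀ = 0 say that
-- these sums vanish for all T ⊆ {τ(1),…,τ(n)}; inverting the triangular system over subsets
-- gives g(n) e_{τ(1)}⋯e_{τ(n)} = 0, and this product is the n-fold Pfister form.

{-# OPTIONS --safe #-}

module Submission where

open import Defs
open import Data.Nat using (ℕ; _≤_)
open import Data.Nat.Properties using (≤-trans)
open import Data.Integer using (ℤ; +_)
open import Data.Fin using (Fin; inject≤)
open import Data.Fin.Permutation using (Permutation′; _⟨$⟩ʳ_)
open import Data.List using (map; concatMap; allFin)
open import Relation.Nullary using (¬_)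
open import Relation.Binary.PropositionalEquality using (_≡_)

open import Level using (_⊔_)
open import Algebra.Bundles using (CommutativeRing)
open import Algebra.Structures using (IsCommutativeRing)
import Algebra.Solver.Ring as RingSolver
open import Algebra.Solver.Ring.AlmostCommutativeRing
  using (fromCommutativeRing; _-Raw-AlmostCommutative⟶_)
open import Data.Bool using (if_then_else_)
open import Data.Empty using (⊥-elim)
open import Data.Maybe using (Maybe; just; nothing)
open import Data.Nat as ℕ using (zero; suc; _∸_; _!; _<_; s≤s; z≤n)
import Data.Nat.Properties as ℕ
open import Data.Nat.Tactic.RingSolver using (solve-∀)
open import Data.Integer as ℤ using (-[1+_]; _⊖_)
import Data.Integer.Properties as ℤ
open import Data.Fin as Fin using (zero; suc; _≟_; cast; punchIn; punchOut)
import Data.Fin.Properties as Fin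
open import Data.Fin.Permutation as Perm
  using (Permutation; _⟨$⟩ˡ_; inverseʳ; inverseˡ; cast-id; transpose; insert; insert-punchIn)
open import Data.List using (List; []; _∷_; _++_; length; lookup; tabulate; foldr; applyUpTo; upTo)
open import Data.List.Properties
  using (length-map; length-tabulate; ++-assoc; ++-identityʳ; map-++; concatMap-++; concatMap-map;
         map-tabulate; tabulate-cong; tabulate-lookup; map-applyUpTo)
open import Data.List.Membership.Propositional.Properties using (∈-lookup)
open import Data.List.Relation.Binary.Pointwise as PW using (Pointwise; []; _∷_)
open import Data.List.Relation.Binary.Permutation.Propositional as ↭ using (_↭_; prep; swap)
import Data.List.Relation.Binary.Permutation.Propositional.Properties as ↭
open import Data.List.Relation.Binary.Sublist.Propositional using (_⊆_; []; _∷_; _∷ʳ_)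
open import Data.List.Relation.Binary.Sublist.Propositional.Properties using (All-resp-⊆; length-mono-≤)
open import Data.List.Relation.Unary.All as All using (All; []; _∷_)
import Data.List.Relation.Unary.All.Properties as All
open import Data.List.Relation.Unary.AllPairs using ([]; _∷_)
open import Data.List.Relation.Unary.Unique.Propositional using (Unique)
import Data.List.Relation.Unary.Unique.Propositional.Properties as Unique
open import Data.Product using (Σ; ∃₂; _,_; proj₁; proj₂)
open import Function using (_∘_)
open import Relation.Binary.Bundles using (Setoid)
import Relation.Binary.Reasoning.Setoid as SetoidReasoning
open import Relation.Nullary using (yes; no; does; contradiction)
import Relation.Binary.PropositionalEquality as ≡
open ≡ using (_≢_)

-- Lists, sublists and permutations

lookup-map : ∀ {a b} {A : Set a} {B : Set b} (f : A → B) (xs : List A) i →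
             lookup (map f xs) (cast (≡.sym (length-map f xs)) i) ≡ f (lookup xs i)
lookup-map f (x ∷ xs) zero    = ≡.refl
lookup-map f (x ∷ xs) (suc i) = lookup-map f xs i

++-swapʳ : ∀ {a} {A : Set a} (xs ys zs : List A) → (xs ++ ys) ++ zs ↭ (xs ++ zs) ++ ys
++-swapʳ xs ys zs = begin
  (xs ++ ys) ++ zs   ≡⟨ ++-assoc xs ys zs ⟩
  xs ++ (ys ++ zs)   ↭⟨ ↭.++⁺ˡ xs (↭.++-comm ys zs) ⟩
  xs ++ (zs ++ ys)   ≡⟨ ++-assoc xs zs ys ⟨
  (xs ++ zs) ++ ys   ∎
  where open ↭.PermutationReasoning

++-interchange : ∀ {a} {A : Set a} (ws xs ys zs : List A) → (ws ++ xs) ++ (ys ++ zs) ↭ (ws ++ ys) ++ (xs ++ zs)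
++-interchange ws xs ys zs = begin
  (ws ++ xs) ++ (ys ++ zs)   ≡⟨ ++-assoc ws xs (ys ++ zs) ⟩
  ws ++ (xs ++ (ys ++ zs))   ↭⟨ ↭.++⁺ˡ ws (↭.shifts xs ys) ⟩
  ws ++ (ys ++ (xs ++ zs))   ≡⟨ ++-assoc ws ys (xs ++ zs) ⟨
  (ws ++ ys) ++ (xs ++ zs)   ∎
  where open ↭.PermutationReasoning

⊆-map⁻ : ∀ {a b} {A : Set a} {B : Set b} (f : A → B) {ys} xs → ys ⊆ map f xs → ∃₂ λ zs (_ : zs ⊆ xs) → ys ≡ map f zs
⊆-map⁻ f []       []           = [] , [] , ≡.refl
⊆-map⁻ f (x ∷ xs) (_ ∷ʳ p)     with ⊆-map⁻ f xs p
... | zs , q , ≡.refl = zs , x ∷ʳ q , ≡.refl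
⊆-map⁻ f (x ∷ xs) (≡.refl ∷ p) with ⊆-map⁻ f xs p
... | zs , q , ≡.refl = x ∷ zs , ≡.refl ∷ q , ≡.refl

Unique-resp-⊇ : ∀ {a} {A : Set a} {xs ys : List A} → Unique ys → xs ⊆ ys → Unique xs
Unique-resp-⊇ []          []           = []
Unique-resp-⊇ (_ ∷ u)     (_ ∷ʳ p)     = Unique-resp-⊇ u p
Unique-resp-⊇ (y∉ys ∷ u)  (≡.refl ∷ p) = All-resp-⊆ p y∉ys ∷ Unique-resp-⊇ u p

Unique⇒lookup-injective : ∀ {a} {A : Set a} {xs : List A} → Unique xs →
                          ∀ {i j} → lookup xs i ≡ lookup xs j → i ≡ j
Unique⇒lookup-injective (_ ∷ u)    {zero}  {zero}  _  = ≡.refl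
Unique⇒lookup-injective (x∉xs ∷ u) {zero}  {suc j} eq = ⊥-elim (All.lookup x∉xs (∈-lookup j) eq)
Unique⇒lookup-injective (x∉xs ∷ u) {suc i} {zero}  eq = ⊥-elim (All.lookup x∉xs (∈-lookup i) (≡.sym eq))
Unique⇒lookup-injective (_ ∷ u)    {suc i} {suc j} eq = ≡.cong suc (Unique⇒lookup-injective u eq)

extend-injection : ∀ {k d} (g : Fin k → Fin d) → (∀ {i j} → g i ≡ g j → i ≡ j) → (k≤d : k ≤ d) →
                   Σ (Permutation′ d) λ σ → ∀ i → σ ⟨$⟩ʳ inject≤ i k≤d ≡ g i
extend-injection {zero}          g g-inj k≤d       = Perm.id , λ ()
extend-injection {suc k} {suc d} g g-inj (s≤s k≤d) = insert zero (g zero) σ , σ-extends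
  where
  g₀≢g∘suc : ∀ i → g zero ≢ g (suc i)
  g₀≢g∘suc i eq with g-inj eq
  ... | ()
  -- the restriction of g to the nonzero indices, as a map into Fin d ≅ Fin (suc d) ∖ {g zero}
  g′ : Fin k → Fin d
  g′ i = punchOut (g₀≢g∘suc i)
  g′-inj : ∀ {i j} → g′ i ≡ g′ j → i ≡ j
  g′-inj {i} {j} eq = Fin.suc-injective (g-inj (Fin.punchOut-injective (g₀≢g∘suc i) (g₀≢g∘suc j) eq))
  σ = proj₁ (extend-injection g′ g′-inj k≤d)
  σ-extends : ∀ i → insert zero (g zero) σ ⟨$⟩ʳ inject≤ i (s≤s k≤d) ≡ g i
  σ-extends zero    = ≡.refl
  σ-extends (suc i) = ≡.trans (insert-punchIn zero (g zero) σ (inject≤ i k≤d))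
                        (≡.trans (≡.cong (punchIn (g zero)) (proj₂ (extend-injection g′ g′-inj k≤d) i))
                                 (Fin.punchIn-punchOut (g₀≢g∘suc i)))

extend-Unique : ∀ {d} (xs : List (Fin d)) → Unique xs → (≤d : length xs ≤ d) →
                Σ (Permutation′ d) λ σ → map (λ i → σ ⟨$⟩ʳ inject≤ i ≤d) (allFin (length xs)) ≡ xs
extend-Unique xs u ≤d = σ , (begin
  map (λ i → σ ⟨$⟩ʳ inject≤ i ≤d) (allFin (length xs))   ≡⟨ map-tabulate (λ i → i) _ ⟩
  tabulate (λ i → σ ⟨$⟩ʳ inject≤ i ≤d)                    ≡⟨ tabulate-cong (proj₂ extension) ⟩
  tabulate (lookup xs)                                     ≡⟨ tabulate-lookup xs ⟩
  xs                                                       ∎)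
  where
  open ≡.≡-Reasoning
  extension = extend-injection (lookup xs) (Unique⇒lookup-injective u) ≤d
  σ = proj₁ extension

-- Stirling numbers and the weights of powers of sums

q<k⇒Stirling₂≡0 : ∀ {q k} → q < k → Stirling₂ q k ≡ 0
q<k⇒Stirling₂≡0 {zero}  {suc k} _ = ≡.refl
q<k⇒Stirling₂≡0 {suc q} {suc k} (s≤s q<k)
  rewrite q<k⇒Stirling₂≡0 (ℕ.m<n⇒m<1+n q<k) | q<k⇒Stirling₂≡0 q<k
  = ≡.trans (ℕ.+-identityʳ (suc k ℕ.* 0)) (ℕ.*-zeroʳ (suc k))

powerWeight : ℕ → ℕ → ℕ
powerWeight q k = 2 ℕ.^ (q ∸ k) ℕ.* k ! ℕ.* Stirling₂ q k

q<k⇒powerWeight≡0 : ∀ {q k} → q < k → powerWeight q k ≡ 0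
q<k⇒powerWeight≡0 {q} {k} q<k =
  ≡.trans (≡.cong (2 ℕ.^ (q ∸ k) ℕ.* k ! ℕ.*_) (q<k⇒Stirling₂≡0 q<k)) (ℕ.*-zeroʳ (2 ℕ.^ (q ∸ k) ℕ.* k !))

powerWeight[1+q,0]≡0 : ∀ q → powerWeight (suc q) 0 ≡ 0
powerWeight[1+q,0]≡0 q = ℕ.*-zeroʳ (2 ℕ.^ suc q ℕ.* 1)

powerWeight[0,1+k]≡0 : ∀ k → powerWeight 0 (suc k) ≡ 0
powerWeight[0,1+k]≡0 k = ℕ.*-zeroʳ (2 ℕ.^ 0 ℕ.* suc k !)

2^[q∸k]*s≡2*2^[q∸1+k]*s : ∀ q k s → (q ≤ k → s ≡ 0) →
                          2 ℕ.^ (q ∸ k) ℕ.* s ≡ 2 ℕ.* 2 ℕ.^ (q ∸ suc k) ℕ.* s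
2^[q∸k]*s≡2*2^[q∸1+k]*s zero    k       s s≡0 rewrite s≡0 z≤n =
  ≡.trans (ℕ.*-zeroʳ (2 ℕ.^ (0 ∸ k))) (≡.sym (ℕ.*-zeroʳ (2 ℕ.* 2 ℕ.^ (0 ∸ suc k))))
2^[q∸k]*s≡2*2^[q∸1+k]*s (suc q) zero    s _   = ≡.refl
2^[q∸k]*s≡2*2^[q∸1+k]*s (suc q) (suc k) s s≡0 = 2^[q∸k]*s≡2*2^[q∸1+k]*s q k s (s≡0 ∘ s≤s)

powerWeight-suc : ∀ q k → powerWeight (suc q) (suc k) ≡
  suc k ℕ.* (powerWeight q (suc k) ℕ.+ powerWeight q (suc k) ℕ.+ powerWeight q k)
powerWeight-suc q k = begin
  a ℕ.* (suc k ℕ.* K) ℕ.* (suc k ℕ.* s ℕ.+ t)                  ≡⟨ expand (suc k) K a s t ⟩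
  suc k ℕ.* (suc k ℕ.* K ℕ.* (a ℕ.* s) ℕ.+ a ℕ.* K ℕ.* t)        ≡⟨ ≡.cong (λ e → suc k ℕ.* (suc k ℕ.* K ℕ.* e ℕ.+ a ℕ.* K ℕ.* t)) a*s≡2*b*s ⟩
  suc k ℕ.* (suc k ℕ.* K ℕ.* (2 ℕ.* b ℕ.* s) ℕ.+ a ℕ.* K ℕ.* t) ≡⟨ regroup (suc k) K b s (a ℕ.* K ℕ.* t) ⟩
  suc k ℕ.* (b ℕ.* (suc k ℕ.* K) ℕ.* s ℕ.+ b ℕ.* (suc k ℕ.* K) ℕ.* s ℕ.+ a ℕ.* K ℕ.* t) ∎
  where
  open ≡.≡-Reasoning
  a = 2 ℕ.^ (q ∸ k)
  b = 2 ℕ.^ (q ∸ suc k)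
  K = k !
  s = Stirling₂ q (suc k)
  t = Stirling₂ q k
  a*s≡2*b*s : a ℕ.* s ≡ 2 ℕ.* b ℕ.* s
  a*s≡2*b*s = 2^[q∸k]*s≡2*2^[q∸1+k]*s q k s (λ q≤k → q<k⇒Stirling₂≡0 (s≤s q≤k))
  expand : ∀ k K a s t → a ℕ.* (k ℕ.* K) ℕ.* (k ℕ.* s ℕ.+ t) ≡ k ℕ.* (k ℕ.* K ℕ.* (a ℕ.* s) ℕ.+ a ℕ.* K ℕ.* t)
  expand = solve-∀
  regroup : ∀ k K b s r → k ℕ.* (k ℕ.* K ℕ.* (2 ℕ.* b ℕ.* s) ℕ.+ r) ≡ k ℕ.* (b ℕ.* (k ℕ.* K) ℕ.* s ℕ.+ b ℕ.* (k ℕ.* K) ℕ.* s ℕ.+ r)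
  regroup = solve-∀

-- The canonical map ℤ → R

module IntegerEmbedding {c ℓ} (R : CommutativeRing c ℓ) where
  open CommutativeRing R hiding (zero)
  open import Algebra.Properties.Semiring.Mult semiring using (_×_; ×-homo-+)
  open import Algebra.Properties.Ring ring using (-‿distribˡ-*; -‿involutive; -0#≈0#)
  open import Algebra.Properties.AbelianGroup +-abelianGroup using (⁻¹-∙-comm)
  open import Relation.Binary.Reasoning.Setoid setoid

  ι : ℤ → Carrier
  ι (+ n)    = n × 1#
  ι -[1+ n ] = - (suc n × 1#)

  ι-neg : ∀ i → ι (ℤ.- i) ≈ - ι i
  ι-neg (+ zero)   = sym -0#≈0#
  ι-neg (+ suc n)  = refl
  ι-neg -[1+ n ]   = sym (-‿involutive _)

  ι-⊖ : ∀ m n → ι (m ⊖ n) ≈ m × 1# + - (n × 1#)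
  ι-⊖ m       zero    = sym (trans (+-congˡ -0#≈0#) (+-identityʳ _))
  ι-⊖ zero    (suc n) = sym (+-identityˡ _)
  ι-⊖ (suc m) (suc n) = begin
    ι (suc m ⊖ suc n)                          ≡⟨ ≡.cong ι (ℤ.[1+m]⊖[1+n]≡m⊖n m n) ⟩
    ι (m ⊖ n)                                  ≈⟨ ι-⊖ m n ⟩
    m × 1# + - (n × 1#)                        ≈⟨ sym (+-identityˡ _) ⟩
    0# + (m × 1# + - (n × 1#))                 ≈⟨ +-congʳ (sym (-‿inverseʳ 1#)) ⟩
    (1# + - 1#) + (m × 1# + - (n × 1#))        ≈⟨ solve 4 (λ a b c d → (a ⊕ b) ⊕ (c ⊕ d) ⊜ (a ⊕ c) ⊕ (b ⊕ d)) refl 1# (- 1#) (m × 1#) _ ⟩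
    (1# + m × 1#) + (- 1# + - (n × 1#))        ≈⟨ +-congˡ (⁻¹-∙-comm 1# (n × 1#)) ⟩
    suc m × 1# + - (suc n × 1#)                ∎
    where open import Algebra.Solver.CommutativeMonoid +-commutativeMonoid using (solve; _⊕_; _⊜_)

  ι-+ : ∀ i j → ι (i ℤ.+ j) ≈ ι i + ι j
  ι-+ (+ m)    (+ n)    = ×-homo-+ 1# m n
  ι-+ (+ m)    -[1+ n ] = ι-⊖ m (suc n)
  ι-+ -[1+ m ] (+ n)    = trans (ι-⊖ n (suc m)) (+-comm _ _)
  ι-+ -[1+ m ] -[1+ n ] = begin
    - (suc (suc (m ℕ.+ n)) × 1#)        ≡⟨ ≡.cong (λ k → - (suc k × 1#)) (≡.sym (ℕ.+-suc m n)) ⟩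
    - ((suc m ℕ.+ suc n) × 1#)          ≈⟨ -‿cong (×-homo-+ 1# (suc m) (suc n)) ⟩
    - (suc m × 1# + suc n × 1#)         ≈⟨ sym (⁻¹-∙-comm _ _) ⟩
    - (suc m × 1#) + - (suc n × 1#)     ∎

  ι-*-+ : ∀ m j → ι (+ m ℤ.* j) ≈ m × 1# * ι j
  ι-*-+ zero    j = sym (zeroˡ (ι j))
  ι-*-+ (suc m) j = begin
    ι (+ suc m ℤ.* j)             ≡⟨ ≡.cong ι (ℤ.suc-* (+ m) j) ⟩
    ι (j ℤ.+ + m ℤ.* j)           ≈⟨ ι-+ j (+ m ℤ.* j) ⟩
    ι j + ι (+ m ℤ.* j)           ≈⟨ +-cong (sym (*-identityˡ (ι j))) (ι-*-+ m j) ⟩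
    1# * ι j + m × 1# * ι j       ≈⟨ sym (distribʳ (ι j) 1# (m × 1#)) ⟩
    suc m × 1# * ι j              ∎

  ι-* : ∀ i j → ι (i ℤ.* j) ≈ ι i * ι j
  ι-* (+ m)    j = ι-*-+ m j
  ι-* -[1+ m ] j = begin
    ι (-[1+ m ] ℤ.* j)            ≡⟨ ≡.cong ι (≡.sym (ℤ.neg-distribˡ-* (+ suc m) j)) ⟩
    ι (ℤ.- (+ suc m ℤ.* j))       ≈⟨ ι-neg (+ suc m ℤ.* j) ⟩
    - ι (+ suc m ℤ.* j)           ≈⟨ -‿cong (ι-*-+ (suc m) j) ⟩
    - (suc m × 1# * ι j)          ≈⟨ -‿distribˡ-* (suc m × 1#) (ι j) ⟩
    - (suc m × 1#) * ι j          ∎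

  private
    R′ = fromCommutativeRing R

    ι-homomorphism : ℤ.+-*-rawRing -Raw-AlmostCommutative⟶ R′
    ι-homomorphism = record
      { ⟦_⟧ = ι ; +-homo = ι-+ ; *-homo = ι-* ; -‿homo = ι-neg ; 0-homo = refl ; 1-homo = +-identityʳ 1# }

    ι-≟ : ∀ i j → Maybe (ι i ≈ ι j)
    ι-≟ i j with i ℤ.≟ j
    ... | yes ≡.refl = just refl
    ... | no  _      = nothing

  module ℤ-Solver = RingSolver ℤ.+-*-rawRing R′ ι-homomorphism ι-≟

-- Subset expansions in a commutative ring

module SubsetExpansion {c ℓ} (R : CommutativeRing c ℓ) where
  open CommutativeRing R
  open import Algebra.Properties.Semiring.Mult semiring using (_×_; ×-congʳ; ×-homo-+; ×-assocˡ)
  open import Algebra.Properties.Semiring.Exp semiring using (_^_)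
  open import Relation.Binary.Reasoning.Setoid setoid
  open import Algebra.Solver.Ring.NaturalCoefficients.Default commutativeSemiring using (solve; _:=_; _:+_; _:*_)

  sumᴸ : List Carrier → Carrier
  sumᴸ = foldr _+_ 0#

  productᴸ : List Carrier → Carrier
  productᴸ = foldr _*_ 1#

  -- subsetSum w xs = Σ_{ys ⊆ xs} w |ys| · productᴸ ys
  subsetSum : (ℕ → Carrier) → List Carrier → Carrier
  subsetSum w []       = w 0
  subsetSum w (x ∷ xs) = subsetSum w xs + x * subsetSum (w ∘ suc) xs

  subsetSum-cong : ∀ {v w} xs → (∀ k → v k ≈ w k) → subsetSum v xs ≈ subsetSum w xs
  subsetSum-cong []       v≈w = v≈w 0
  subsetSum-cong (x ∷ xs) v≈w = +-cong (subsetSum-cong xs v≈w) (*-congˡ (subsetSum-cong xs (v≈w ∘ suc)))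

  subsetSum-+ : ∀ v w xs → subsetSum (λ k → v k + w k) xs ≈ subsetSum v xs + subsetSum w xs
  subsetSum-+ v w []       = refl
  subsetSum-+ v w (x ∷ xs) = begin
    subsetSum (λ k → v k + w k) xs + x * subsetSum (λ k → v (suc k) + w (suc k)) xs
      ≈⟨ +-cong (subsetSum-+ v w xs) (*-congˡ (subsetSum-+ (v ∘ suc) (w ∘ suc) xs)) ⟩
    (subsetSum v xs + subsetSum w xs) + x * (subsetSum (v ∘ suc) xs + subsetSum (w ∘ suc) xs)
      ≈⟨ solve 5 (λ a b x c d → (a :+ b) :+ x :* (c :+ d) := (a :+ x :* c) :+ (b :+ x :* d)) refl _ _ x _ _ ⟩
    subsetSum v (x ∷ xs) + subsetSum w (x ∷ xs) ∎

  subsetSum-*ˡ : ∀ a w xs → subsetSum (λ k → a * w k) xs ≈ a * subsetSum w xs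
  subsetSum-*ˡ a w []       = refl
  subsetSum-*ˡ a w (x ∷ xs) = begin
    subsetSum (λ k → a * w k) xs + x * subsetSum (λ k → a * w (suc k)) xs
      ≈⟨ +-cong (subsetSum-*ˡ a w xs) (*-congˡ (subsetSum-*ˡ a (w ∘ suc) xs)) ⟩
    a * subsetSum w xs + x * (a * subsetSum (w ∘ suc) xs)
      ≈⟨ solve 4 (λ a b x c → a :* b :+ x :* (a :* c) := a :* (b :+ x :* c)) refl a _ x _ ⟩
    a * subsetSum w (x ∷ xs) ∎

  subsetSum-unit : ∀ w xs → (∀ k → w (suc k) ≈ 0#) → subsetSum w xs ≈ w 0
  subsetSum-unit w []       _ = refl
  subsetSum-unit w (x ∷ xs) w≈0 = begin
    subsetSum w xs + x * subsetSum (w ∘ suc) xs       ≈⟨ +-cong (subsetSum-unit w xs w≈0) (*-congˡ (subsetSum-unit (w ∘ suc) xs (w≈0 ∘ suc))) ⟩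
    w 0 + x * w 1                                     ≈⟨ +-congˡ (trans (*-congˡ (w≈0 0)) (zeroʳ x)) ⟩
    w 0 + 0#                                          ≈⟨ +-identityʳ (w 0) ⟩
    w 0                                               ∎

  SquareIsDouble : Carrier → Set ℓ
  SquareIsDouble e = e * e ≈ e + e

  -- In (Σ eᵢ) · Σ_T w |T| e_T the coefficient of e_U, |U| = k, collects 2 w k from eᵢ e_U = 2 e_U
  -- and w (k - 1) from eᵢ e_{U∖i} = e_U, once for each i ∈ U.
  sumMultiplier : (ℕ → Carrier) → ℕ → Carrier
  sumMultiplier w zero    = 0#
  sumMultiplier w (suc k) = suc k × (w (suc k) + w (suc k) + w k)

  sumMultiplier-suc : ∀ w k →
    (w k + (w (suc k) + w (suc k))) + sumMultiplier (w ∘ suc) k ≈ sumMultiplier w (suc k)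
  sumMultiplier-suc w zero    = +-congʳ (+-comm _ _)
  sumMultiplier-suc w (suc k) = +-congʳ (+-comm _ _)

  sumᴸ*subsetSum : ∀ {xs} → All SquareIsDouble xs → ∀ w →
                  sumᴸ xs * subsetSum w xs ≈ subsetSum (sumMultiplier w) xs
  sumᴸ*subsetSum []                 w = zeroˡ (w 0)
  sumᴸ*subsetSum {e ∷ xs} (e²≈2e ∷ d) w = begin
    (e + s) * (A + e * B)
      ≈⟨ solve 4 (λ e s A B → (e :+ s) :* (A :+ e :* B) := s :* A :+ (e :* (A :+ s :* B) :+ (e :* e) :* B)) refl e s A B ⟩
    s * A + (e * (A + s * B) + (e * e) * B)
      ≈⟨ +-cong (sumᴸ*subsetSum d w) (+-congˡ (*-congʳ e²≈2e)) ⟩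
    subsetSum (sumMultiplier w) xs + (e * (A + s * B) + (e + e) * B)
      ≈⟨ +-congˡ (solve 4 (λ e s A B → e :* (A :+ s :* B) :+ (e :+ e) :* B := e :* ((A :+ (B :+ B)) :+ s :* B)) refl e s A B) ⟩
    subsetSum (sumMultiplier w) xs + e * ((A + (B + B)) + s * B)
      ≈⟨ +-congˡ (*-congˡ (+-congˡ (sumᴸ*subsetSum d (w ∘ suc)))) ⟩
    subsetSum (sumMultiplier w) xs + e * ((A + (B + B)) + subsetSum (sumMultiplier (w ∘ suc)) xs)
      ≈⟨ +-congˡ (*-congˡ shifted) ⟩
    subsetSum (sumMultiplier w) (e ∷ xs) ∎
    where
    s = sumᴸ xs
    A = subsetSum w xs
    B = subsetSum (w ∘ suc) xs
    shifted : (A + (B + B)) + subsetSum (sumMultiplier (w ∘ suc)) xs ≈ subsetSum (sumMultiplier w ∘ suc) xs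
    shifted = begin
      (A + (B + B)) + subsetSum (sumMultiplier (w ∘ suc)) xs
        ≈⟨ +-congʳ (+-congˡ (sym (subsetSum-+ (w ∘ suc) (w ∘ suc) xs))) ⟩
      (A + subsetSum (λ k → w (suc k) + w (suc k)) xs) + subsetSum (sumMultiplier (w ∘ suc)) xs
        ≈⟨ +-congʳ (sym (subsetSum-+ w _ xs)) ⟩
      subsetSum (λ k → w k + (w (suc k) + w (suc k))) xs + subsetSum (sumMultiplier (w ∘ suc)) xs
        ≈⟨ sym (subsetSum-+ _ _ xs) ⟩
      subsetSum (λ k → (w k + (w (suc k) + w (suc k))) + sumMultiplier (w ∘ suc) k) xs
        ≈⟨ subsetSum-cong xs (sumMultiplier-suc w) ⟩
      subsetSum (sumMultiplier w ∘ suc) xs ∎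

  sumMultiplier-powerWeight : ∀ q k →
    sumMultiplier (λ j → powerWeight q j × 1#) k ≈ powerWeight (suc q) k × 1#
  sumMultiplier-powerWeight q zero    = reflexive (≡.cong (_× 1#) (≡.sym (powerWeight[1+q,0]≡0 q)))
  sumMultiplier-powerWeight q (suc k) = sym (begin
    powerWeight (suc q) (suc k) × 1#    ≡⟨ ≡.cong (_× 1#) (powerWeight-suc q k) ⟩
    (suc k ℕ.* (w₁ ℕ.+ w₁ ℕ.+ w₀)) × 1# ≈⟨ sym (×-assocˡ 1# (suc k) (w₁ ℕ.+ w₁ ℕ.+ w₀)) ⟩
    suc k × ((w₁ ℕ.+ w₁ ℕ.+ w₀) × 1#)   ≈⟨ ×-congʳ (suc k) (trans (×-homo-+ 1# (w₁ ℕ.+ w₁) w₀) (+-congʳ (×-homo-+ 1# w₁ w₁))) ⟩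
    suc k × (w₁ × 1# + w₁ × 1# + w₀ × 1#) ∎)
    where
    w₁ = powerWeight q (suc k)
    w₀ = powerWeight q k

  sumᴸ^q≈subsetSum : ∀ {xs} → All SquareIsDouble xs → ∀ q → sumᴸ xs ^ q ≈ subsetSum (λ k → powerWeight q k × 1#) xs
  sumᴸ^q≈subsetSum {xs} d zero    = sym (trans (subsetSum-unit _ xs (λ k → reflexive (≡.cong (_× 1#) (powerWeight[0,1+k]≡0 k))))
                                    (+-identityʳ 1#))
  sumᴸ^q≈subsetSum {xs} d (suc q) = begin
    sumᴸ xs * sumᴸ xs ^ q                                      ≈⟨ *-congˡ (sumᴸ^q≈subsetSum d q) ⟩
    sumᴸ xs * subsetSum (λ k → powerWeight q k × 1#) xs         ≈⟨ sumᴸ*subsetSum d _ ⟩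
    subsetSum (sumMultiplier (λ k → powerWeight q k × 1#)) xs  ≈⟨ subsetSum-cong xs (sumMultiplier-powerWeight q) ⟩
    subsetSum (λ k → powerWeight (suc q) k × 1#) xs ∎

  polynomial : (ℕ → Carrier) → List ℕ → Carrier → Carrier
  polynomial a qs x = sumᴸ (map (λ q → a q * x ^ q) qs)

  weightedCoefficient : (ℕ → Carrier) → List ℕ → ℕ → Carrier
  weightedCoefficient a qs k = sumᴸ (map (λ q → a q * (powerWeight q k × 1#)) qs)

  polynomial-at-0 : ∀ a d → polynomial a (upTo (suc d)) 0# ≈ a 0
  polynomial-at-0 a d = trans (+-cong (*-identityʳ (a 0)) (positive-powers (λ q → q) d)) (+-identityʳ (a 0))
    where
    positive-powers : ∀ (g : ℕ → ℕ) k → polynomial a (applyUpTo (suc ∘ g) k) 0# ≈ 0#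
    positive-powers g zero    = refl
    positive-powers g (suc k) =
      trans (+-cong (trans (*-congˡ (zeroˡ (0# ^ g 0))) (zeroʳ (a (suc (g 0))))) (positive-powers (g ∘ suc) k))
            (+-identityʳ 0#)

  polynomial-sumᴸ≈subsetSum : ∀ {xs} → All SquareIsDouble xs → ∀ a qs →
                   polynomial a qs (sumᴸ xs) ≈ subsetSum (weightedCoefficient a qs) xs
  polynomial-sumᴸ≈subsetSum {xs} d a []       = sym (subsetSum-unit (λ _ → 0#) xs (λ _ → refl))
  polynomial-sumᴸ≈subsetSum {xs} d a (q ∷ qs) = begin
    a q * sumᴸ xs ^ q + polynomial a qs (sumᴸ xs)
      ≈⟨ +-cong (*-congˡ (sumᴸ^q≈subsetSum d q)) (polynomial-sumᴸ≈subsetSum d a qs) ⟩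
    a q * subsetSum (λ k → powerWeight q k × 1#) xs + subsetSum (weightedCoefficient a qs) xs
      ≈⟨ +-congʳ (sym (subsetSum-*ˡ (a q) _ xs)) ⟩
    subsetSum (λ k → a q * (powerWeight q k × 1#)) xs + subsetSum (weightedCoefficient a qs) xs
      ≈⟨ sym (subsetSum-+ _ _ xs) ⟩
    subsetSum (weightedCoefficient a (q ∷ qs)) xs ∎

  subsetSum-inversion : ∀ xs w z → (∀ {ys} → ys ⊆ xs → z * subsetSum w ys ≈ 0#) →
                        z * (w (length xs) * productᴸ xs) ≈ 0#
  subsetSum-inversion []       w z H = trans (*-congˡ (*-identityʳ (w 0))) (H [])
  subsetSum-inversion (x ∷ xs) w z H = begin
    z * (w (suc (length xs)) * (x * productᴸ xs))
      ≈⟨ solve 4 (λ z w x p → z :* (w :* (x :* p)) := (z :* x) :* (w :* p)) refl z _ x _ ⟩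
    (z * x) * (w (suc (length xs)) * productᴸ xs)
      ≈⟨ subsetSum-inversion xs (w ∘ suc) (z * x) H′ ⟩
    0# ∎
    where
    -- the terms of the subset sums over ys and x ∷ ys that do not contain x agree
    H′ : ∀ {ys} → ys ⊆ xs → (z * x) * subsetSum (w ∘ suc) ys ≈ 0#
    H′ {ys} p = begin
      (z * x) * subsetSum (w ∘ suc) ys                           ≈⟨ sym (+-identityˡ _) ⟩
      0# + (z * x) * subsetSum (w ∘ suc) ys                      ≈⟨ +-congʳ (sym (H (x ∷ʳ p))) ⟩
      z * subsetSum w ys + (z * x) * subsetSum (w ∘ suc) ys
        ≈⟨ solve 4 (λ z a x b → z :* a :+ (z :* x) :* b := z :* (a :+ x :* b)) refl z _ x _ ⟩
      z * subsetSum w (x ∷ ys)                                   ≈⟨ H (≡.refl ∷ p) ⟩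
      0# ∎

  vanishesOnSubsums⇒weightedCoefficient*product≈0 :
    ∀ {xs} → All SquareIsDouble xs → ∀ a qs →
    (∀ {ys} → ys ⊆ xs → polynomial a qs (sumᴸ ys) ≈ 0#) →
    weightedCoefficient a qs (length xs) * productᴸ xs ≈ 0#
  vanishesOnSubsums⇒weightedCoefficient*product≈0 {xs} d a qs H =
    trans (sym (*-identityˡ _)) (subsetSum-inversion xs _ 1# λ p →
      trans (*-identityˡ _) (trans (sym (polynomial-sumᴸ≈subsetSum (All-resp-⊆ p d) a qs)) (H p)))

module CoefficientSum {c ℓ} (R : CommutativeRing c ℓ) where
  open CommutativeRing R
  open import Algebra.Properties.Semiring.Mult semiring using (_×_)
  open SubsetExpansion R using (sumᴸ; weightedCoefficient)
  open IntegerEmbedding R using (ι; ι-+; ι-*)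
  open import Relation.Binary.Reasoning.Setoid setoid

  sumᴸ-applyUpTo-cong : ∀ {g h : ℕ → Carrier} k → (∀ i → g i ≈ h i) → sumᴸ (applyUpTo g k) ≈ sumᴸ (applyUpTo h k)
  sumᴸ-applyUpTo-cong zero    g≈h = refl
  sumᴸ-applyUpTo-cong (suc k) g≈h = +-cong (g≈h 0) (sumᴸ-applyUpTo-cong k (g≈h ∘ suc))

  sumᴸ-applyUpTo-dropZeros : ∀ h m k → (∀ i → i < m → h i ≈ 0#) →
                             sumᴸ (applyUpTo h (m ℕ.+ k)) ≈ sumᴸ (applyUpTo (λ j → h (m ℕ.+ j)) k)
  sumᴸ-applyUpTo-dropZeros h zero    k h≈0 = refl
  sumᴸ-applyUpTo-dropZeros h (suc m) k h≈0 =
    trans (+-cong (h≈0 0 (s≤s z≤n)) (sumᴸ-applyUpTo-dropZeros (h ∘ suc) m k (λ i i<m → h≈0 (suc i) (s≤s i<m))))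
          (+-identityˡ _)

  ι-sumᴸ : ∀ (zs : List ℤ) → ι (foldr ℤ._+_ (+ 0) zs) ≈ sumᴸ (map ι zs)
  ι-sumᴸ []       = refl
  ι-sumᴸ (z ∷ zs) = trans (ι-+ z _) (+-congˡ (ι-sumᴸ zs))

  ι-coefficientSum : ∀ f {n d} → n ≤ d → ι (coefficientSum f n d) ≈ weightedCoefficient (ι ∘ f) (upTo (suc d)) n
  ι-coefficientSum f {n} {d} n≤d = begin
    ι (coefficientSum f n d)                                    ≈⟨ ι-sumᴸ (map term (upTo (suc (d ∸ n)))) ⟩
    sumᴸ (map ι (map term (upTo (suc (d ∸ n)))))                ≡⟨ ≡.cong (sumᴸ ∘ map ι) (map-applyUpTo (λ j → j) term (suc (d ∸ n))) ⟩
    sumᴸ (map ι (applyUpTo term (suc (d ∸ n))))                 ≡⟨ ≡.cong sumᴸ (map-applyUpTo term ι (suc (d ∸ n))) ⟩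
    sumᴸ (applyUpTo (ι ∘ term) (suc (d ∸ n)))                   ≈⟨ sumᴸ-applyUpTo-cong (suc (d ∸ n)) ι-term ⟩
    sumᴸ (applyUpTo (λ j → ω (n ℕ.+ j)) (suc (d ∸ n)))          ≈⟨ sym (sumᴸ-applyUpTo-dropZeros ω n (suc (d ∸ n)) ω≈0) ⟩
    sumᴸ (applyUpTo ω (n ℕ.+ suc (d ∸ n)))                      ≡⟨ ≡.cong (sumᴸ ∘ applyUpTo ω) (≡.trans (ℕ.+-suc n (d ∸ n)) (≡.cong suc (ℕ.m+[n∸m]≡n n≤d))) ⟩
    sumᴸ (applyUpTo ω (suc d))                                  ≡⟨ ≡.cong sumᴸ (map-applyUpTo (λ q → q) ω (suc d)) ⟨
    weightedCoefficient (ι ∘ f) (upTo (suc d)) n                ∎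
    where
    term : ℕ → ℤ
    term j = + (2 ℕ.^ j ℕ.* n ! ℕ.* Stirling₂ (n ℕ.+ j) n) ℤ.* f (n ℕ.+ j)
    ω : ℕ → Carrier
    ω q = ι (f q) * (powerWeight q n × 1#)
    ι-term : ∀ j → ι (term j) ≈ ω (n ℕ.+ j)
    ι-term j = trans (ι-* (+ (2 ℕ.^ j ℕ.* n ! ℕ.* Stirling₂ (n ℕ.+ j) n)) (f (n ℕ.+ j)))
                     (trans (*-comm _ _) (*-congˡ (reflexive (≡.cong (_× 1#) powerWeight≡))))
      where
      powerWeight≡ : 2 ℕ.^ j ℕ.* n ! ℕ.* Stirling₂ (n ℕ.+ j) n ≡ powerWeight (n ℕ.+ j) n
      powerWeight≡ = ≡.cong (λ e → 2 ℕ.^ e ℕ.* n ! ℕ.* Stirling₂ (n ℕ.+ j) n) (≡.sym (ℕ.m+n∸m≡n n j))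
    ω≈0 : ∀ q → q < n → ω q ≈ 0#
    ω≈0 q q<n = trans (*-congˡ (reflexive (≡.cong (_× 1#) (q<k⇒powerWeight≡0 q<n)))) (zeroʳ _)

-- Matrices and isometries of diagonal forms

module Matrices {c ℓ} (R : CommutativeRing c ℓ) where
  open CommutativeRing R hiding (zero)
  open import Algebra.Properties.Semiring.Sum semiring
    using (sum; sum-cong-≋; sum-replicate-zero; ∑-comm; *-distribˡ-sum; *-distribʳ-sum)
  open import Algebra.Solver.CommutativeMonoid *-commutativeMonoid using (solve; _⊜_) renaming (_⊕_ to _∙_)
  module ≈-Reasoning = SetoidReasoning setoid

  private variable
    m n p q : ℕ

  Matrix : ℕ → ℕ → Set c
  Matrix m n = Fin m → Fin n → Carrier

  infix 4 _≋_
  _≋_ : Matrix m n → Matrix m n → Set ℓ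
  A ≋ B = ∀ i j → A i j ≈ B i j

  ≋-setoid : ℕ → ℕ → Setoid c ℓ
  ≋-setoid m n = record
    { Carrier       = Matrix m n
    ; _≈_           = _≋_
    ; isEquivalence = record
      { refl  = λ _ _ → refl
      ; sym   = λ A≋B i j → sym (A≋B i j)
      ; trans = λ A≋B B≋C i j → trans (A≋B i j) (B≋C i j)
      }
    }

  module ≋-Reasoning {m n} = SetoidReasoning (≋-setoid m n)
  open module ≋ {m n} = Setoid (≋-setoid m n) using () renaming (refl to ≋-refl; sym to ≋-sym)

  infixl 7 _·_
  _·_ : Matrix m n → Matrix n p → Matrix m p
  (A · B) i k = sum λ j → A i j * B j k

  _ᵀ : Matrix m n → Matrix n m
  (A ᵀ) j i = A i j

  1ᴹ : Matrix m m
  1ᴹ i j = if does (i ≟ j) then 1# else 0#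

  diag : (Fin m → Carrier) → Matrix m m
  diag u i j = 1ᴹ i j * u i

  gram : (Fin m → Carrier) → Matrix m n → Matrix n n
  gram u A j j′ = sum λ i → A i j * (u i * A i j′)

  sum-zero : ∀ {f : Fin m → Carrier} → (∀ i → f i ≈ 0#) → sum f ≈ 0#
  sum-zero {m} f≈0 = trans (sum-cong-≋ f≈0) (sum-replicate-zero m)

  1ᴹ-refl : ∀ (i : Fin m) → 1ᴹ i i ≡ 1#
  1ᴹ-refl zero    = ≡.refl
  1ᴹ-refl (suc i) = 1ᴹ-refl i

  1ᴹ-≢ : ∀ {i j : Fin m} → i ≢ j → 1ᴹ i j ≡ 0#
  1ᴹ-≢ {i = zero}  {zero}  i≢j = contradiction ≡.refl i≢j
  1ᴹ-≢ {i = zero}  {suc j} _   = ≡.refl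
  1ᴹ-≢ {i = suc i} {zero}  _   = ≡.refl
  1ᴹ-≢ {i = suc i} {suc j} i≢j = 1ᴹ-≢ (i≢j ∘ ≡.cong suc)

  1ᴹ-sym : ∀ (i j : Fin m) → 1ᴹ i j ≡ 1ᴹ j i
  1ᴹ-sym zero    zero    = ≡.refl
  1ᴹ-sym zero    (suc j) = ≡.refl
  1ᴹ-sym (suc i) zero    = ≡.refl
  1ᴹ-sym (suc i) (suc j) = 1ᴹ-sym i j

  1ᴹ-injective : ∀ (π : Fin m → Fin n) → (∀ {i j} → π i ≡ π j → i ≡ j) →
                 ∀ i j → 1ᴹ (π i) (π j) ≡ 1ᴹ i j
  1ᴹ-injective π π-inj i j with i ≟ j
  ... | yes ≡.refl = 1ᴹ-refl (π i)
  ... | no  i≢j    = 1ᴹ-≢ (i≢j ∘ π-inj)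

  sum-1ᴹˡ : ∀ (i : Fin m) (f : Fin m → Carrier) → sum (λ j → 1ᴹ i j * f j) ≈ f i
  sum-1ᴹˡ {suc m} zero    f = begin
    1# * f zero + sum (λ j → 0# * f (suc j))     ≈⟨ +-cong (*-identityˡ (f zero)) (sum-zero (λ j → zeroˡ (f (suc j)))) ⟩
    f zero + 0#                                   ≈⟨ +-identityʳ (f zero) ⟩
    f zero                                        ∎
    where open ≈-Reasoning
  sum-1ᴹˡ {suc m} (suc i) f = begin
    0# * f zero + sum (λ j → 1ᴹ i j * f (suc j))  ≈⟨ +-cong (zeroˡ (f zero)) (sum-1ᴹˡ i (f ∘ suc)) ⟩
    0# + f (suc i)                                ≈⟨ +-identityˡ (f (suc i)) ⟩
    f (suc i)                                     ∎
    where open ≈-Reasoning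

  sum-1ᴹʳ : ∀ (i : Fin m) (f : Fin m → Carrier) → sum (λ j → f j * 1ᴹ j i) ≈ f i
  sum-1ᴹʳ i f = trans (sum-cong-≋ λ j → trans (*-comm (f j) _) (*-congʳ (reflexive (1ᴹ-sym j i)))) (sum-1ᴹˡ i f)

  ·-cong : ∀ {A A′ : Matrix m n} {B B′ : Matrix n p} → A ≋ A′ → B ≋ B′ → A · B ≋ A′ · B′
  ·-cong A≋A′ B≋B′ i k = sum-cong-≋ λ j → *-cong (A≋A′ i j) (B≋B′ j k)

  ·-assoc : ∀ (A : Matrix m n) (B : Matrix n p) (C : Matrix p q) → (A · B) · C ≋ A · (B · C)
  ·-assoc A B C i l = begin
    sum (λ k → sum (λ j → A i j * B j k) * C k l)    ≈⟨ sum-cong-≋ (λ k → *-distribʳ-sum (C k l) (λ j → A i j * B j k)) ⟩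
    sum (λ k → sum (λ j → (A i j * B j k) * C k l))  ≈⟨ ∑-comm (λ k j → (A i j * B j k) * C k l) ⟩
    sum (λ j → sum (λ k → (A i j * B j k) * C k l))  ≈⟨ sum-cong-≋ (λ j → sum-cong-≋ λ k → *-assoc (A i j) (B j k) (C k l)) ⟩
    sum (λ j → sum (λ k → A i j * (B j k * C k l)))  ≈⟨ sum-cong-≋ (λ j → sym (*-distribˡ-sum (A i j) (λ k → B j k * C k l))) ⟩
    sum (λ j → A i j * sum (λ k → B j k * C k l))    ∎
    where open ≈-Reasoning

  ·-identityˡ : ∀ (A : Matrix m n) → 1ᴹ · A ≋ A
  ·-identityˡ A i k = sum-1ᴹˡ i (λ j → A j k)

  ᵀ-· : ∀ (A : Matrix m n) (B : Matrix n p) → (A · B) ᵀ ≋ B ᵀ · A ᵀ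
  ᵀ-· A B k i = sum-cong-≋ λ j → *-comm (A i j) (B j k)

  ·-inverse : ∀ {A : Matrix m n} {A′ : Matrix n m} {B : Matrix n p} {B′ : Matrix p n} →
              A · A′ ≋ 1ᴹ → B · B′ ≋ 1ᴹ → (A · B) · (B′ · A′) ≋ 1ᴹ
  ·-inverse {A = A} {A′} {B} {B′} AA′≋1 BB′≋1 = begin
    (A · B) · (B′ · A′)   ≈⟨ ·-assoc A B _ ⟩
    A · (B · (B′ · A′))   ≈⟨ ·-cong ≋-refl (≋-sym (·-assoc B B′ A′)) ⟩
    A · ((B · B′) · A′)   ≈⟨ ·-cong ≋-refl (·-cong BB′≋1 ≋-refl) ⟩
    A · (1ᴹ · A′)         ≈⟨ ·-cong ≋-refl (·-identityˡ A′) ⟩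
    A · A′                ≈⟨ AA′≋1 ⟩
    1ᴹ                    ∎
    where open ≋-Reasoning

  gram-congʳ : ∀ u {A B : Matrix m n} → A ≋ B → gram u A ≋ gram u B
  gram-congʳ u A≋B j j′ = sum-cong-≋ λ i → *-cong (A≋B i j) (*-congˡ (A≋B i j′))

  gram≋ᵀ·diag· : ∀ u (A : Matrix m n) → gram u A ≋ A ᵀ · (diag u · A)
  gram≋ᵀ·diag· u A j j′ = sum-cong-≋ λ i → *-congˡ (sym (begin
    sum (λ k → 1ᴹ i k * u i * A k j′)    ≈⟨ sum-cong-≋ (λ k → *-assoc (1ᴹ i k) (u i) (A k j′)) ⟩
    sum (λ k → 1ᴹ i k * (u i * A k j′))  ≈⟨ sum-1ᴹˡ i (λ k → u i * A k j′) ⟩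
    u i * A i j′                          ∎))
    where open ≈-Reasoning

  gram-· : ∀ u (A : Matrix m n) (B : Matrix n p) → gram u (A · B) ≋ B ᵀ · (gram u A · B)
  gram-· u A B = begin
    gram u (A · B)                        ≈⟨ gram≋ᵀ·diag· u (A · B) ⟩
    (A · B) ᵀ · (diag u · (A · B))        ≈⟨ ·-cong (ᵀ-· A B) (≋-sym (·-assoc (diag u) A B)) ⟩
    (B ᵀ · A ᵀ) · ((diag u · A) · B)      ≈⟨ ·-assoc (B ᵀ) (A ᵀ) _ ⟩
    B ᵀ · (A ᵀ · ((diag u · A) · B))      ≈⟨ ·-cong ≋-refl (≋-sym (·-assoc (A ᵀ) (diag u · A) B)) ⟩
    B ᵀ · ((A ᵀ · (diag u · A)) · B)      ≈⟨ ·-cong ≋-refl (·-cong (≋-sym (gram≋ᵀ·diag· u A)) ≋-refl) ⟩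
    B ᵀ · (gram u A · B)                  ∎
    where open ≋-Reasoning

  gram-1ᴹ : ∀ (u : Fin m → Carrier) → gram u 1ᴹ ≋ diag u
  gram-1ᴹ u j j′ = begin
    sum (λ i → 1ᴹ i j * (u i * 1ᴹ i j′))  ≈⟨ sum-cong-≋ (λ i → *-congʳ (reflexive (1ᴹ-sym i j))) ⟩
    sum (λ i → 1ᴹ j i * (u i * 1ᴹ i j′))  ≈⟨ sum-1ᴹˡ j (λ i → u i * 1ᴹ i j′) ⟩
    u j * 1ᴹ j j′                         ≈⟨ *-comm (u j) _ ⟩
    1ᴹ j j′ * u j                         ∎
    where open ≈-Reasoning

  infixr 5 _⊕_
  _⊕_ : Carrier → Matrix m n → Matrix (suc m) (suc n)
  (a ⊕ A) zero    zero    = a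
  (a ⊕ A) zero    (suc j) = 0#
  (a ⊕ A) (suc i) zero    = 0#
  (a ⊕ A) (suc i) (suc j) = A i j

  ⊕-cong : ∀ {a b} {A B : Matrix m n} → a ≈ b → A ≋ B → a ⊕ A ≋ b ⊕ B
  ⊕-cong a≈b A≋B zero    zero    = a≈b
  ⊕-cong a≈b A≋B zero    (suc j) = refl
  ⊕-cong a≈b A≋B (suc i) zero    = refl
  ⊕-cong a≈b A≋B (suc i) (suc j) = A≋B i j

  1ᴹ≋1⊕1ᴹ : 1ᴹ ≋ 1# ⊕ 1ᴹ {m}
  1ᴹ≋1⊕1ᴹ zero    zero    = refl
  1ᴹ≋1⊕1ᴹ zero    (suc j) = refl
  1ᴹ≋1⊕1ᴹ (suc i) zero    = refl
  1ᴹ≋1⊕1ᴹ (suc i) (suc j) = refl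

  diag≋⊕ : ∀ (u : Fin (suc m) → Carrier) → diag u ≋ 1# * u zero ⊕ diag (u ∘ suc)
  diag≋⊕ u zero    zero    = refl
  diag≋⊕ u zero    (suc j) = zeroˡ (u zero)
  diag≋⊕ u (suc i) zero    = zeroˡ (u (suc i))
  diag≋⊕ u (suc i) (suc j) = refl

  private
    head+zeros : ∀ {x y} {f : Fin m → Carrier} → x ≈ y → (∀ i → f i ≈ 0#) → x + sum f ≈ y
    head+zeros x≈y f≈0 = trans (+-cong x≈y (sum-zero f≈0)) (+-identityʳ _)

    zero+tail : ∀ {x s y} → x ≈ 0# → s ≈ y → x + s ≈ y
    zero+tail x≈0 s≈y = trans (+-cong x≈0 s≈y) (+-identityˡ _)

    0*x*0 : ∀ x → 0# * (x * 0#) ≈ 0#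
    0*x*0 x = zeroˡ (x * 0#)

  ⊕-· : ∀ a b (A : Matrix m n) (B : Matrix n p) → (a ⊕ A) · (b ⊕ B) ≋ a * b ⊕ A · B
  ⊕-· {n = n} a b A B zero zero = head+zeros refl (λ (j : Fin n) → zeroˡ 0#)
  ⊕-· a b A B zero    (suc k) = head+zeros (zeroʳ a) (λ j → zeroˡ (B j k))
  ⊕-· a b A B (suc i) zero    = head+zeros (zeroˡ b) (λ j → zeroʳ (A i j))
  ⊕-· a b A B (suc i) (suc k) = zero+tail (zeroˡ 0#) refl

  gram-⊕ : ∀ u a (A : Matrix m n) → gram u (a ⊕ A) ≋ a * (u zero * a) ⊕ gram (u ∘ suc) A
  gram-⊕ u a A zero    zero    = head+zeros refl (λ i → 0*x*0 (u (suc i)))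
  gram-⊕ u a A zero    (suc j) = head+zeros (trans (*-congˡ (zeroʳ (u zero))) (zeroʳ a)) (λ i → zeroˡ (u (suc i) * A i j))
  gram-⊕ u a A (suc j) zero    = head+zeros (zeroˡ _) (λ i → trans (*-congˡ (zeroʳ (u (suc i)))) (zeroʳ (A i j)))
  gram-⊕ u a A (suc j) (suc k) = zero+tail (0*x*0 (u zero)) refl

  record Isometry (u : Fin m → Carrier) (v : Fin n → Carrier) : Set (c ⊔ ℓ) where
    field
      M      : Matrix m n
      M⁻¹    : Matrix n m
      M·M⁻¹  : M · M⁻¹ ≋ 1ᴹ
      M⁻¹·M  : M⁻¹ · M ≋ 1ᴹ
      gram-M : gram u M ≋ diag v

  open Isometry

  Isometry-trans : ∀ {u : Fin m → Carrier} {v : Fin n → Carrier} {w : Fin p → Carrier} →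
                   Isometry u v → Isometry v w → Isometry u w
  Isometry-trans {u = u} {v} {w} f g = record
    { M      = M f · M g
    ; M⁻¹    = M⁻¹ g · M⁻¹ f
    ; M·M⁻¹  = ·-inverse {A = M f} {B = M g} (M·M⁻¹ f) (M·M⁻¹ g)
    ; M⁻¹·M  = ·-inverse {A = M⁻¹ g} {B = M⁻¹ f} (M⁻¹·M g) (M⁻¹·M f)
    ; gram-M = begin
        gram u (M f · M g)              ≈⟨ gram-· u (M f) (M g) ⟩
        M g ᵀ · (gram u (M f) · M g)    ≈⟨ ·-cong ≋-refl (·-cong (gram-M f) ≋-refl) ⟩
        M g ᵀ · (diag v · M g)          ≈⟨ ≋-sym (gram≋ᵀ·diag· v (M g)) ⟩
        gram v (M g)                    ≈⟨ gram-M g ⟩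
        diag w                          ∎
    }
    where open ≋-Reasoning

  Isometry-sym : ∀ {u : Fin m → Carrier} {v : Fin n → Carrier} → Isometry u v → Isometry v u
  Isometry-sym {u = u} {v} f = record
    { M      = M⁻¹ f
    ; M⁻¹    = M f
    ; M·M⁻¹  = M⁻¹·M f
    ; M⁻¹·M  = M·M⁻¹ f
    ; gram-M = begin
        gram v (M⁻¹ f)                      ≈⟨ gram≋ᵀ·diag· v (M⁻¹ f) ⟩
        M⁻¹ f ᵀ · (diag v · M⁻¹ f)          ≈⟨ ·-cong ≋-refl (·-cong (≋-sym (gram-M f)) ≋-refl) ⟩
        M⁻¹ f ᵀ · (gram u (M f) · M⁻¹ f)    ≈⟨ ≋-sym (gram-· u (M f) (M⁻¹ f)) ⟩
        gram u (M f · M⁻¹ f)                ≈⟨ gram-congʳ u (M·M⁻¹ f) ⟩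
        gram u 1ᴹ                           ≈⟨ gram-1ᴹ u ⟩
        diag u                              ∎
    }
    where open ≋-Reasoning

  Isometry-reindex : ∀ {u : Fin m → Carrier} {v : Fin n → Carrier} (π : Permutation n m) →
                     (∀ j → v j ≈ u (π ⟨$⟩ʳ j)) → Isometry u v
  Isometry-reindex {u = u} {v} π v≈u∘π = record
    { M      = λ i j → 1ᴹ i (π ⟨$⟩ʳ j)
    ; M⁻¹    = λ j i → 1ᴹ j (π ⟨$⟩ˡ i)
    ; M·M⁻¹  = λ i i′ → trans (sum-1ᴹʳ (π ⟨$⟩ˡ i′) (λ j → 1ᴹ i (π ⟨$⟩ʳ j))) (reflexive (≡.cong (1ᴹ i) (inverseʳ π)))
    ; M⁻¹·M  = λ j j′ → trans (sum-1ᴹʳ (π ⟨$⟩ʳ j′) (λ i → 1ᴹ j (π ⟨$⟩ˡ i))) (reflexive (≡.cong (1ᴹ j) (inverseˡ π)))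
    ; gram-M = λ j j′ → begin
        sum (λ i → 1ᴹ i (π ⟨$⟩ʳ j) * (u i * 1ᴹ i (π ⟨$⟩ʳ j′)))
          ≈⟨ sum-cong-≋ (λ i → *-congʳ (reflexive (1ᴹ-sym i (π ⟨$⟩ʳ j)))) ⟩
        sum (λ i → 1ᴹ (π ⟨$⟩ʳ j) i * (u i * 1ᴹ i (π ⟨$⟩ʳ j′)))
          ≈⟨ sum-1ᴹˡ (π ⟨$⟩ʳ j) (λ i → u i * 1ᴹ i (π ⟨$⟩ʳ j′)) ⟩
        u (π ⟨$⟩ʳ j) * 1ᴹ (π ⟨$⟩ʳ j) (π ⟨$⟩ʳ j′)
          ≈⟨ *-comm _ _ ⟩
        1ᴹ (π ⟨$⟩ʳ j) (π ⟨$⟩ʳ j′) * u (π ⟨$⟩ʳ j)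
          ≈⟨ *-cong (reflexive (1ᴹ-injective (π ⟨$⟩ʳ_) π-injective j j′)) (sym (v≈u∘π j)) ⟩
        1ᴹ j j′ * v j ∎
    }
    where
    open ≈-Reasoning
    π-injective : ∀ {j j′} → π ⟨$⟩ʳ j ≡ π ⟨$⟩ʳ j′ → j ≡ j′
    π-injective {j} {j′} eq = ≡.trans (≡.sym (inverseˡ π)) (≡.trans (≡.cong (π ⟨$⟩ˡ_) eq) (inverseˡ π))

  Isometry-scale : ∀ {u : Fin m → Carrier} {v : Fin n → Carrier} x →
                   Isometry u v → Isometry (λ i → x * u i) (λ j → x * v j)
  Isometry-scale {u = u} {v} x f = record
    { M      = M f
    ; M⁻¹    = M⁻¹ f
    ; M·M⁻¹  = M·M⁻¹ f
    ; M⁻¹·M  = M⁻¹·M f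
    ; gram-M = λ j j′ → begin
        sum (λ i → M f i j * ((x * u i) * M f i j′))
          ≈⟨ sum-cong-≋ (λ i → solve 4 (λ a x u b → a ∙ ((x ∙ u) ∙ b) ⊜ x ∙ (a ∙ (u ∙ b))) refl (M f i j) x (u i) (M f i j′)) ⟩
        sum (λ i → x * (M f i j * (u i * M f i j′)))
          ≈⟨ sym (*-distribˡ-sum x (λ i → M f i j * (u i * M f i j′))) ⟩
        x * gram u (M f) j j′
          ≈⟨ *-congˡ (gram-M f j j′) ⟩
        x * (1ᴹ j j′ * v j)
          ≈⟨ solve 3 (λ x d v → x ∙ (d ∙ v) ⊜ d ∙ (x ∙ v)) refl x (1ᴹ j j′) (v j) ⟩
        1ᴹ j j′ * (x * v j) ∎
    }
    where open ≈-Reasoning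

  Isometry-∷ : ∀ {u : Fin (suc m) → Carrier} {v : Fin (suc n) → Carrier} →
               u zero ≈ v zero → Isometry (u ∘ suc) (v ∘ suc) → Isometry u v
  Isometry-∷ {u = u} {v} u₀≈v₀ f = record
    { M      = 1# ⊕ M f
    ; M⁻¹    = 1# ⊕ M⁻¹ f
    ; M·M⁻¹  = lift (M·M⁻¹ f)
    ; M⁻¹·M  = lift (M⁻¹·M f)
    ; gram-M = begin
        gram u (1# ⊕ M f)                                 ≈⟨ gram-⊕ u 1# (M f) ⟩
        1# * (u zero * 1#) ⊕ gram (u ∘ suc) (M f)         ≈⟨ ⊕-cong (*-congˡ (trans (*-identityʳ _) u₀≈v₀)) (gram-M f) ⟩
        1# * v zero ⊕ diag (v ∘ suc)                      ≈⟨ ≋-sym (diag≋⊕ v) ⟩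
        diag v                                            ∎
    }
    where
    open ≋-Reasoning
    lift : ∀ {k l} {A : Matrix k l} {B : Matrix l k} → A · B ≋ 1ᴹ → (1# ⊕ A) · (1# ⊕ B) ≋ 1ᴹ
    lift {A = A} {B} AB≋1 = begin
      (1# ⊕ A) · (1# ⊕ B)   ≈⟨ ⊕-· 1# 1# A B ⟩
      1# * 1# ⊕ A · B       ≈⟨ ⊕-cong (*-identityˡ 1#) AB≋1 ⟩
      1# ⊕ 1ᴹ               ≈⟨ ≋-sym 1ᴹ≋1⊕1ᴹ ⟩
      1ᴹ                    ∎

module FormIsometry {c ℓ} (F : Field c ℓ) where
  open Field F hiding (zero)
  open Witt F using (Form; ∑; Isometric)
  open Matrices commutativeRing
    using (Isometry; Isometry-trans; Isometry-sym; Isometry-reindex; Isometry-scale; Isometry-∷)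
  open import Algebra.Properties.Semiring.Sum semiring using (sum)

  infix 4 _≅_
  record _≅_ (φ ψ : Form) : Set (c ⊔ ℓ) where
    constructor isometric
    field isometry : Isometry (lookup φ) (lookup ψ)

  ≅-refl : ∀ {φ} → φ ≅ φ
  ≅-refl = isometric (Isometry-reindex Perm.id (λ _ → refl))

  ≅-sym : ∀ {φ ψ} → φ ≅ ψ → ψ ≅ φ
  ≅-sym (isometric f) = isometric (Isometry-sym f)

  ≅-trans : ∀ {φ ψ χ} → φ ≅ ψ → ψ ≅ χ → φ ≅ χ
  ≅-trans (isometric f) (isometric g) = isometric (Isometry-trans f g)

  ≅-reflexive : ∀ {φ ψ} → φ ≡ ψ → φ ≅ ψ
  ≅-reflexive ≡.refl = ≅-refl

  ≅-setoid : Setoid c (c ⊔ ℓ)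
  ≅-setoid = record
    { Carrier = Form ; _≈_ = _≅_
    ; isEquivalence = record { refl = ≅-refl ; sym = ≅-sym ; trans = ≅-trans }
    }

  module ≅-Reasoning = SetoidReasoning ≅-setoid

  ≅-∷ : ∀ {x y φ ψ} → x ≈ y → φ ≅ ψ → x ∷ φ ≅ y ∷ ψ
  ≅-∷ x≈y (isometric f) = isometric (Isometry-∷ x≈y f)

  ≅-pointwise : ∀ {φ ψ} → Pointwise _≈_ φ ψ → φ ≅ ψ
  ≅-pointwise []           = ≅-refl
  ≅-pointwise (x≈y ∷ φ≈ψ) = ≅-∷ x≈y (≅-pointwise φ≈ψ)

  ≅-swap : ∀ x y φ → x ∷ y ∷ φ ≅ y ∷ x ∷ φ
  ≅-swap x y φ = isometric (Isometry-reindex (transpose zero (suc zero)) λ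
    { zero → refl ; (suc zero) → refl ; (suc (suc j)) → refl })

  ↭⇒≅ : ∀ {φ ψ} → φ ↭ ψ → φ ≅ ψ
  ↭⇒≅ ↭.refl        = ≅-refl
  ↭⇒≅ (prep x p)    = ≅-∷ refl (↭⇒≅ p)
  ↭⇒≅ (swap x y p)  = ≅-trans (≅-swap x y _) (≅-∷ refl (≅-∷ refl (↭⇒≅ p)))
  ↭⇒≅ (↭.trans p q) = ≅-trans (↭⇒≅ p) (↭⇒≅ q)

  ≅-++ʳ : ∀ φ {ψ ψ′} → ψ ≅ ψ′ → φ ++ ψ ≅ φ ++ ψ′
  ≅-++ʳ []      ψ≅ψ′ = ψ≅ψ′
  ≅-++ʳ (x ∷ φ) ψ≅ψ′ = ≅-∷ refl (≅-++ʳ φ ψ≅ψ′)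

  ≅-++ : ∀ {φ φ′ ψ ψ′} → φ ≅ φ′ → ψ ≅ ψ′ → φ ++ ψ ≅ φ′ ++ ψ′
  ≅-++ {φ} {φ′} {ψ} {ψ′} φ≅φ′ ψ≅ψ′ = begin
    φ ++ ψ     ≈⟨ ≅-++ʳ φ ψ≅ψ′ ⟩
    φ ++ ψ′    ≈⟨ ↭⇒≅ (↭.++-comm φ ψ′) ⟩
    ψ′ ++ φ    ≈⟨ ≅-++ʳ ψ′ φ≅φ′ ⟩
    ψ′ ++ φ′   ≈⟨ ↭⇒≅ (↭.++-comm ψ′ φ′) ⟩
    φ′ ++ ψ′   ∎
    where open ≅-Reasoning

  ≅-map : ∀ {f : Carrier → Carrier} x → (∀ y → f y ≈ x * y) →
          ∀ {φ ψ} → φ ≅ ψ → map f φ ≅ map f ψ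
  ≅-map {f} x f≈x* {φ} {ψ} (isometric g) =
    isometric (Isometry-trans (unscale φ) (Isometry-trans (Isometry-scale x g) (Isometry-sym (unscale ψ))))
    where
    unscale : ∀ φ → Isometry (lookup (map f φ)) (λ i → x * lookup φ i)
    unscale φ = Isometry-reindex (cast-id (≡.sym (length-map f φ))) λ j →
      trans (sym (f≈x* (lookup φ j))) (reflexive (≡.sym (lookup-map f φ j)))

  ⟨b²⟩≅⟨1⟩ : ∀ {b} → ¬ b ≈ 0# → b * b ∷ [] ≅ 1# ∷ []
  ⟨b²⟩≅⟨1⟩ {b} b≉0 = isometric record
    { M      = λ _ _ → b⁻¹
    ; M⁻¹    = λ _ _ → b
    ; M·M⁻¹  = λ { zero zero → trans (+-identityʳ _) (trans (*-comm b⁻¹ b) b*b⁻¹≈1) }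
    ; M⁻¹·M  = λ { zero zero → trans (+-identityʳ _) b*b⁻¹≈1 }
    ; gram-M = λ { zero zero → trans (+-identityʳ _) (trans (b⁻¹b²b⁻¹ b b⁻¹) (*-cong b*b⁻¹≈1 b*b⁻¹≈1)) }
    }
    where
    b⁻¹ = proj₁ (inverse b b≉0)
    b*b⁻¹≈1 = proj₂ (inverse b b≉0)
    b⁻¹b²b⁻¹ : ∀ b t → t * ((b * b) * t) ≈ (b * t) * (b * t)
    b⁻¹b²b⁻¹ = solve 2 (λ b t → t ∙ ((b ∙ b) ∙ t) ⊜ (b ∙ t) ∙ (b ∙ t)) refl
      where open import Algebra.Solver.CommutativeMonoid *-commutativeMonoid using (solve; _⊜_) renaming (_⊕_ to _∙_)

  ∑≡sum : ∀ m (f : Fin m → Carrier) → ∑ m f ≡ sum f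
  ∑≡sum zero    f = ≡.refl
  ∑≡sum (suc m) f = ≡.cong (_+_ (f zero)) (∑≡sum m (λ i → f (suc i)))

  Isometric⇒≅ : ∀ {φ ψ} → Isometric φ ψ → φ ≅ ψ
  Isometric⇒≅ {φ} {ψ} (M , M⁻¹ , M·M⁻¹ , M⁻¹·M , gram-M) = isometric record
    { M      = M
    ; M⁻¹    = M⁻¹
    ; M·M⁻¹  = λ i i′ → trans (reflexive (≡.sym (∑≡sum (length ψ) _))) (M·M⁻¹ i i′)
    ; M⁻¹·M  = λ j j′ → trans (reflexive (≡.sym (∑≡sum (length φ) _))) (M⁻¹·M j j′)
    ; gram-M = λ j j′ → trans (reflexive (≡.sym (∑≡sum (length φ) _))) (gram-M j j′)
    }

  ≅⇒Isometric : ∀ {φ ψ} → φ ≅ ψ → Isometric φ ψ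
  ≅⇒Isometric {φ} {ψ} (isometric f) =
    M , M⁻¹ ,
    (λ i i′ → trans (reflexive (∑≡sum (length ψ) _)) (M·M⁻¹ i i′)) ,
    (λ j j′ → trans (reflexive (∑≡sum (length φ) _)) (M⁻¹·M j j′)) ,
    (λ j j′ → trans (reflexive (∑≡sum (length φ) _)) (gram-M j j′))
    where open Isometry f

module _ {c ℓ} (F : Field c ℓ) where
  open Field F

  Characteristic≢2 : Set ℓ
  Characteristic≢2 = ¬ (1# + 1# ≈ 0#)

  Nonzero : Carrier → Set ℓ
  Nonzero x = ¬ x ≈ 0#

module HyperbolicPlane {c ℓ} (F : Field c ℓ) (2≉0 : Characteristic≢2 F) where
  open Field F hiding (zero)
  open Witt F using (hyperbolicPlane)
  open FormIsometry F
  open Matrices commutativeRing using (Matrix)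
  open IntegerEmbedding commutativeRing using (module ℤ-Solver)
  open ℤ-Solver using (solve; _:=_; _:+_; _:*_; :-_; con)

  ⟨a,-a⟩≅H : ∀ {a} → ¬ a ≈ 0# → a ∷ - a ∷ [] ≅ hyperbolicPlane
  ⟨a,-a⟩≅H {a} a≉0 = isometric record
    { M      = circulant p q
    ; M⁻¹    = circulant r s
    ; M·M⁻¹  = λ { zero zero             → trans sum₂ pr+qs≈1
                 ; zero (suc zero)       → trans sum₂ ps+qr≈0
                 ; (suc zero) zero       → trans sum₂ (trans (+-comm _ _) ps+qr≈0)
                 ; (suc zero) (suc zero) → trans sum₂ (trans (+-comm _ _) pr+qs≈1) }
    ; M⁻¹·M  = λ { zero zero             → trans sum₂ (trans (+-cong (*-comm r p) (*-comm s q)) pr+qs≈1)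
                 ; zero (suc zero)       → trans sum₂ (trans (+-cong (*-comm r q) (*-comm s p)) (trans (+-comm _ _) ps+qr≈0))
                 ; (suc zero) zero       → trans sum₂ (trans (+-cong (*-comm s p) (*-comm r q)) ps+qr≈0)
                 ; (suc zero) (suc zero) → trans sum₂ (trans (+-cong (*-comm s q) (*-comm r p)) (trans (+-comm _ _) pr+qs≈1)) }
    ; gram-M = λ { zero zero             → trans sum₂ (trans norm≈1 (sym (*-identityˡ 1#)))
                 ; zero (suc zero)       → trans sum₂ (trans (orthogonal p q) (sym (zeroˡ 1#)))
                 ; (suc zero) zero       → trans sum₂ (trans (orthogonal q p) (sym (zeroˡ (- 1#))))
                 ; (suc zero) (suc zero) → trans sum₂ (trans norm′ (sym (*-identityˡ (- 1#)))) }
    }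
    where
    t = proj₁ (inverse a a≉0)
    h = proj₁ (inverse (1# + 1#) 2≉0)
    at≈1 : a * t ≈ 1#
    at≈1 = proj₂ (inverse a a≉0)
    h+h≈1 : h + h ≈ 1#
    h+h≈1 = trans (sym (trans (distribʳ h 1# 1#) (+-cong (*-identityˡ h) (*-identityˡ h))))
                  (proj₂ (inverse (1# + 1#) 2≉0))
    p = h * (1# + t)
    q = h * (1# + - t)
    r = h * (1# + a)
    s = h * (1# + - a)
    circulant : Carrier → Carrier → Matrix 2 2
    circulant x y zero       zero       = x
    circulant x y zero       (suc zero) = y
    circulant x y (suc zero) zero       = y
    circulant x y (suc zero) (suc zero) = x
    sum₂ : ∀ {x y} → x + (y + 0#) ≈ x + y
    sum₂ = +-congˡ (+-identityʳ _)
    h+h*1 : (h + h) * (h + h * (a * t)) ≈ 1#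
    h+h*1 = trans (*-cong h+h≈1 (+-congˡ (trans (*-congˡ at≈1) (*-identityʳ h)))) (trans (*-identityˡ _) h+h≈1)
    -- the solver variable o stands for 1#, since the solver reads the constant 1 as ι (+ 1) = 1# + 0#
    pr+qs≈1 : p * r + q * s ≈ 1#
    pr+qs≈1 = trans (solve 4 (λ h t a o → (h :* (o :+ t)) :* (h :* (o :+ a)) :+ (h :* (o :+ :- t)) :* (h :* (o :+ :- a))
                                   := (h :+ h) :* (h :* o :* o :+ h :* (a :* t))) refl h t a 1#)
                    (trans (*-congˡ (+-congʳ (trans (*-assoc h 1# 1#) (trans (*-congˡ (*-identityʳ 1#)) (*-identityʳ h))))) h+h*1)
    ps+qr≈0 : p * s + q * r ≈ 0#
    ps+qr≈0 = trans (solve 4 (λ h t a o → (h :* (o :+ t)) :* (h :* (o :+ :- a)) :+ (h :* (o :+ :- t)) :* (h :* (o :+ a))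
                                   := (h :+ h) :* (h :* (o :* o :+ :- (a :* t)))) refl h t a 1#)
                    (trans (*-congˡ (*-congˡ (trans (+-cong (*-identityʳ 1#) (-‿cong at≈1)) (-‿inverseʳ 1#))))
                           (trans (*-congˡ (zeroʳ h)) (zeroʳ _)))
    norm≈1 : p * (a * p) + q * (- a * q) ≈ 1#
    norm≈1 = trans (solve 4 (λ h t a o → (h :* (o :+ t)) :* (a :* (h :* (o :+ t))) :+ (h :* (o :+ :- t)) :* (:- a :* (h :* (o :+ :- t)))
                                  := (h :+ h) :* ((h :+ h) :* (a :* t :* o))) refl h t a 1#)
                   (trans (*-cong h+h≈1 (*-cong h+h≈1 (trans (*-identityʳ _) at≈1))) (trans (*-identityˡ _) (*-identityˡ 1#)))
    norm′ : q * (a * q) + p * (- a * p) ≈ - 1#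
    norm′ = trans (solve 4 (λ h t a o → (h :* (o :+ :- t)) :* (a :* (h :* (o :+ :- t))) :+ (h :* (o :+ t)) :* (:- a :* (h :* (o :+ t)))
                                 := :- ((h :* (o :+ t)) :* (a :* (h :* (o :+ t))) :+ (h :* (o :+ :- t)) :* (:- a :* (h :* (o :+ :- t))))) refl h t a 1#)
                  (-‿cong norm≈1)
    orthogonal : ∀ x y → x * (a * y) + y * (- a * x) ≈ 0#
    orthogonal x y = solve 3 (λ a x y → x :* (a :* y) :+ y :* (:- a :* x) := con (ℤ.+ 0)) refl a x y

-- The Witt ring

module WittRing {c ℓ} (F : Field c ℓ) (2≉0 : Characteristic≢2 F) where
  open Field F hiding (zero)
  open Witt F using (Form; hyperbolicPlane; _⊗_; negForm; _·_; IsZeroW)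
  open FormIsometry F
  open HyperbolicPlane F 2≉0
  open import Algebra.Properties.Ring ring using (-‿distribˡ-*; -‿involutive; -0#≈0#)

  private
    H : Form
    H = hyperbolicPlane

  ·-+ : ∀ m k φ → (m ℕ.+ k) · φ ≡ m · φ ++ k · φ
  ·-+ zero    k φ = ≡.refl
  ·-+ (suc m) k φ = ≡.trans (≡.cong (φ ++_) (·-+ m k φ)) (≡.sym (++-assoc φ (m · φ) (k · φ)))

  infix 4 _~_
  record _~_ (φ ψ : Form) : Set (c ⊔ ℓ) where
    constructor witt
    field
      m k      : ℕ
      isometry : φ ++ m · H ≅ ψ ++ k · H

  ~-refl : ∀ {φ} → φ ~ φ
  ~-refl = witt 0 0 ≅-refl

  ~-sym : ∀ {φ ψ} → φ ~ ψ → ψ ~ φ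
  ~-sym (witt m k φ≅ψ) = witt k m (≅-sym φ≅ψ)

  ~-trans : ∀ {φ ψ χ} → φ ~ ψ → ψ ~ χ → φ ~ χ
  ~-trans {φ} {ψ} {χ} (witt m k φ≅ψ) (witt m′ k′ ψ≅χ) = witt (m ℕ.+ m′) (k′ ℕ.+ k) (begin
    φ ++ (m ℕ.+ m′) · H      ≈⟨ ≅-reflexive (≡.trans (≡.cong (φ ++_) (·-+ m m′ H)) (≡.sym (++-assoc φ (m · H) (m′ · H)))) ⟩
    (φ ++ m · H) ++ m′ · H   ≈⟨ ≅-++ φ≅ψ ≅-refl ⟩
    (ψ ++ k · H) ++ m′ · H   ≈⟨ ↭⇒≅ (++-swapʳ ψ (k · H) (m′ · H)) ⟩
    (ψ ++ m′ · H) ++ k · H   ≈⟨ ≅-++ ψ≅χ ≅-refl ⟩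
    (χ ++ k′ · H) ++ k · H   ≈⟨ ≅-reflexive (≡.trans (++-assoc χ (k′ · H) (k · H)) (≡.cong (χ ++_) (≡.sym (·-+ k′ k H)))) ⟩
    χ ++ (k′ ℕ.+ k) · H      ∎)
    where open ≅-Reasoning

  ~-setoid : Setoid c (c ⊔ ℓ)
  ~-setoid = record
    { Carrier = Form ; _≈_ = _~_
    ; isEquivalence = record { refl = ~-refl ; sym = ~-sym ; trans = ~-trans }
    }

  module ~-Reasoning = SetoidReasoning ~-setoid

  ≅⇒~ : ∀ {φ ψ} → φ ≅ ψ → φ ~ ψ
  ≅⇒~ φ≅ψ = witt 0 0 (≅-++ φ≅ψ ≅-refl)

  ~-++ : ∀ {φ φ′ ψ ψ′} → φ ~ φ′ → ψ ~ ψ′ → φ ++ ψ ~ φ′ ++ ψ′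
  ~-++ {φ} {φ′} {ψ} {ψ′} (witt m k φ≅φ′) (witt m′ k′ ψ≅ψ′) = witt (m ℕ.+ m′) (k ℕ.+ k′) (begin
    (φ ++ ψ) ++ (m ℕ.+ m′) · H        ≈⟨ ≅-reflexive (≡.cong ((φ ++ ψ) ++_) (·-+ m m′ H)) ⟩
    (φ ++ ψ) ++ (m · H ++ m′ · H)     ≈⟨ ↭⇒≅ (++-interchange φ ψ (m · H) (m′ · H)) ⟩
    (φ ++ m · H) ++ (ψ ++ m′ · H)     ≈⟨ ≅-++ φ≅φ′ ψ≅ψ′ ⟩
    (φ′ ++ k · H) ++ (ψ′ ++ k′ · H)   ≈⟨ ↭⇒≅ (++-interchange φ′ (k · H) ψ′ (k′ · H)) ⟩
    (φ′ ++ ψ′) ++ (k · H ++ k′ · H)   ≈⟨ ≅-reflexive (≡.cong ((φ′ ++ ψ′) ++_) (≡.sym (·-+ k k′ H))) ⟩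
    (φ′ ++ ψ′) ++ (k ℕ.+ k′) · H      ∎)
    where open ≅-Reasoning

  IsZeroW⇒~[] : ∀ {φ} → IsZeroW φ → φ ~ []
  IsZeroW⇒~[] (m , k , φ≅kH) = witt m k (Isometric⇒≅ φ≅kH)

  ~[]⇒IsZeroW : ∀ {φ} → φ ~ [] → IsZeroW φ
  ~[]⇒IsZeroW (witt m k φ≅kH) = m , k , ≅⇒Isometric φ≅kH

  Nonsingular : Form → Set (c ⊔ ℓ)
  Nonsingular = All (λ a → ¬ a ≈ 0#)

  ++-negForm≅·H : ∀ {φ} → Nonsingular φ → φ ++ negForm φ ≅ length φ · H
  ++-negForm≅·H {[]}    []             = ≅-refl
  ++-negForm≅·H {a ∷ φ} (a≉0 ∷ φ-ns) = ≅-trans (↭⇒≅ (prep a (↭.shift (- a) φ (negForm φ))))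
                                               (≅-++ (⟨a,-a⟩≅H a≉0) (++-negForm≅·H φ-ns))

  ++-negForm~[] : ∀ {φ} → Nonsingular φ → φ ++ negForm φ ~ []
  ++-negForm~[] {φ} φ-ns = witt 0 (length φ) (≅-trans (≅-reflexive (++-identityʳ _)) (++-negForm≅·H φ-ns))

  ⊗-zeroʳ : ∀ φ → φ ⊗ [] ≡ []
  ⊗-zeroʳ []      = ≡.refl
  ⊗-zeroʳ (a ∷ φ) = ⊗-zeroʳ φ

  ⊗-distribʳ-++ : ∀ φ φ′ ψ → (φ ++ φ′) ⊗ ψ ≡ φ ⊗ ψ ++ φ′ ⊗ ψ
  ⊗-distribʳ-++ φ φ′ ψ = concatMap-++ (λ a → map (a *_) ψ) φ φ′

  ≅-⊗ʳ : ∀ φ {ψ ψ′} → ψ ≅ ψ′ → φ ⊗ ψ ≅ φ ⊗ ψ′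
  ≅-⊗ʳ []      ψ≅ψ′ = ≅-refl
  ≅-⊗ʳ (a ∷ φ) ψ≅ψ′ = ≅-++ (≅-map a (λ _ → refl) ψ≅ψ′) (≅-⊗ʳ φ ψ≅ψ′)

  ⊗-comm : ∀ φ ψ → φ ⊗ ψ ≅ ψ ⊗ φ
  ⊗-comm φ []      = ≅-reflexive (⊗-zeroʳ φ)
  ⊗-comm φ (b ∷ ψ) = ≅-trans (↭⇒≅ (extract φ)) (≅-++ (≅-pointwise (commute φ)) (⊗-comm φ ψ))
    where
    extract : ∀ φ → φ ⊗ (b ∷ ψ) ↭ map (_* b) φ ++ φ ⊗ ψ
    extract []      = ↭.refl
    extract (a ∷ φ) = prep (a * b) (↭.trans (↭.++⁺ˡ (map (a *_) ψ) (extract φ))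
                                            (↭.shifts (map (a *_) ψ) (map (_* b) φ)))
    commute : ∀ φ → Pointwise _≈_ (map (_* b) φ) (map (b *_) φ)
    commute []      = []
    commute (a ∷ φ) = *-comm a b ∷ commute φ

  ≅-⊗ˡ : ∀ {φ φ′} ψ → φ ≅ φ′ → φ ⊗ ψ ≅ φ′ ⊗ ψ
  ≅-⊗ˡ {φ} {φ′} ψ φ≅φ′ = ≅-trans (⊗-comm φ ψ) (≅-trans (≅-⊗ʳ ψ φ≅φ′) (⊗-comm ψ φ′))

  ⊗-assoc : ∀ φ ψ χ → (φ ⊗ ψ) ⊗ χ ≅ φ ⊗ (ψ ⊗ χ)
  ⊗-assoc []      ψ χ = ≅-refl
  ⊗-assoc (a ∷ φ) ψ χ = ≅-trans (≅-reflexive (⊗-distribʳ-++ (map (a *_) ψ) (φ ⊗ ψ) χ))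
                                (≅-++ (≅-pointwise (scale-⊗ ψ)) (⊗-assoc φ ψ χ))
    where
    scale-⊗ : ∀ ψ → Pointwise _≈_ (map (a *_) ψ ⊗ χ) (map (a *_) (ψ ⊗ χ))
    scale-⊗ []      = []
    scale-⊗ (b ∷ ψ) = ≡.subst (Pointwise _≈_ (map (a *_) (b ∷ ψ) ⊗ χ)) (≡.sym (map-++ (a *_) (map (b *_) χ) (ψ ⊗ χ)))
                             (PW.++⁺ (assoc χ) (scale-⊗ ψ))
      where
      assoc : ∀ χ → Pointwise _≈_ (map ((a * b) *_) χ) (map (a *_) (map (b *_) χ))
      assoc []      = []
      assoc (x ∷ χ) = *-assoc a b x ∷ assoc χ

  map-≈-id : ∀ {f : Carrier → Carrier} → (∀ x → f x ≈ x) → ∀ φ → Pointwise _≈_ (map f φ) φ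
  map-≈-id f≈id []      = []
  map-≈-id f≈id (x ∷ φ) = f≈id x ∷ map-≈-id f≈id φ

  ⊗-identityˡ : ∀ φ → (1# ∷ []) ⊗ φ ≅ φ
  ⊗-identityˡ φ = ≅-trans (≅-reflexive (++-identityʳ _)) (≅-pointwise (map-≈-id *-identityˡ φ))

  negForm≅⟨-1⟩⊗ : ∀ φ → negForm φ ≅ (- 1# ∷ []) ⊗ φ
  negForm≅⟨-1⟩⊗ φ = ≅-trans (≅-pointwise (neg≈-1* φ)) (≅-reflexive (≡.sym (++-identityʳ _)))
    where
    neg≈-1* : ∀ φ → Pointwise _≈_ (negForm φ) (map (- 1# *_) φ)
    neg≈-1* []      = []
    neg≈-1* (x ∷ φ) = trans (-‿cong (sym (*-identityˡ x))) (-‿distribˡ-* 1# x) ∷ neg≈-1* φ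

  H⊗≅++negForm : ∀ ψ → H ⊗ ψ ≅ ψ ++ negForm ψ
  H⊗≅++negForm ψ = ≅-++ (≅-pointwise (map-≈-id *-identityˡ ψ)) (≅-sym (negForm≅⟨-1⟩⊗ ψ))

  ·H⊗~[] : ∀ m {ψ} → Nonsingular ψ → (m · H) ⊗ ψ ~ []
  ·H⊗~[] zero    ψ-ns = ~-refl
  ·H⊗~[] (suc m) {ψ} ψ-ns = begin
    (H ++ m · H) ⊗ ψ        ≡⟨ ⊗-distribʳ-++ H (m · H) ψ ⟩
    H ⊗ ψ ++ (m · H) ⊗ ψ    ≈⟨ ~-++ (~-trans (≅⇒~ (H⊗≅++negForm ψ)) (++-negForm~[] ψ-ns)) (·H⊗~[] m ψ-ns) ⟩
    []                      ∎
    where open ~-Reasoning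

  ~-++-zeroʳ : ∀ {φ ψ} → ψ ~ [] → φ ++ ψ ~ φ
  ~-++-zeroʳ {φ} ψ~[] = ~-trans (~-++ (~-refl {φ}) ψ~[]) (≅⇒~ (≅-reflexive (++-identityʳ φ)))

  ~-⊗ˡ : ∀ {φ φ′} ψ → Nonsingular ψ → φ ~ φ′ → φ ⊗ ψ ~ φ′ ⊗ ψ
  ~-⊗ˡ {φ} {φ′} ψ ψ-ns (witt m k φ≅φ′) = begin
    φ ⊗ ψ                       ≈⟨ ~-sym (~-++-zeroʳ (·H⊗~[] m ψ-ns)) ⟩
    φ ⊗ ψ ++ (m · H) ⊗ ψ        ≡⟨ ⊗-distribʳ-++ φ (m · H) ψ ⟨
    (φ ++ m · H) ⊗ ψ            ≈⟨ ≅⇒~ (≅-⊗ˡ ψ φ≅φ′) ⟩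
    (φ′ ++ k · H) ⊗ ψ           ≡⟨ ⊗-distribʳ-++ φ′ (k · H) ψ ⟩
    φ′ ⊗ ψ ++ (k · H) ⊗ ψ       ≈⟨ ~-++-zeroʳ (·H⊗~[] k ψ-ns) ⟩
    φ′ ⊗ ψ                      ∎
    where open ~-Reasoning

  ~-⊗ʳ : ∀ φ {ψ ψ′} → Nonsingular φ → ψ ~ ψ′ → φ ⊗ ψ ~ φ ⊗ ψ′
  ~-⊗ʳ φ {ψ} {ψ′} φ-ns ψ~ψ′ = ~-trans (≅⇒~ (⊗-comm φ ψ)) (~-trans (~-⊗ˡ φ φ-ns ψ~ψ′) (≅⇒~ (⊗-comm ψ′ φ)))

  *-nonzero : ∀ {a b} → ¬ a ≈ 0# → ¬ b ≈ 0# → ¬ a * b ≈ 0#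
  *-nonzero {a} {b} a≉0 b≉0 ab≈0 = b≉0 (begin
    b                 ≈⟨ *-identityˡ b ⟨
    1# * b            ≈⟨ *-congʳ (trans (*-comm a⁻¹ a) a*a⁻¹≈1) ⟨
    (a⁻¹ * a) * b     ≈⟨ *-assoc a⁻¹ a b ⟩
    a⁻¹ * (a * b)     ≈⟨ *-congˡ ab≈0 ⟩
    a⁻¹ * 0#          ≈⟨ zeroʳ a⁻¹ ⟩
    0#                ∎)
    where
    open SetoidReasoning setoid
    a⁻¹ = proj₁ (inverse a a≉0)
    a*a⁻¹≈1 = proj₂ (inverse a a≉0)

  -‿nonzero : ∀ {a} → ¬ a ≈ 0# → ¬ - a ≈ 0#
  -‿nonzero {a} a≉0 -a≈0 = a≉0 (trans (sym (-‿involutive a)) (trans (-‿cong -a≈0) -0#≈0#))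

  ~-negForm : ∀ {φ ψ} → φ ~ ψ → negForm φ ~ negForm ψ
  ~-negForm {φ} {ψ} φ~ψ = begin
    negForm φ             ≈⟨ ≅⇒~ (negForm≅⟨-1⟩⊗ φ) ⟩
    (- 1# ∷ []) ⊗ φ       ≈⟨ ~-⊗ʳ (- 1# ∷ []) (-‿nonzero 1≉0 ∷ []) φ~ψ ⟩
    (- 1# ∷ []) ⊗ ψ       ≈⟨ ≅⇒~ (negForm≅⟨-1⟩⊗ ψ) ⟨
    negForm ψ             ∎
    where open ~-Reasoning

  Nonsingular-⊗ : ∀ {φ ψ} → Nonsingular φ → Nonsingular ψ → Nonsingular (φ ⊗ ψ)
  Nonsingular-⊗ []             ψ-ns = []
  Nonsingular-⊗ (a≉0 ∷ φ-ns) ψ-ns = All.++⁺ (All.gmap⁺ (*-nonzero a≉0) ψ-ns) (Nonsingular-⊗ φ-ns ψ-ns)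

  NonsingularForm : Set (c ⊔ ℓ)
  NonsingularForm = Σ Form Nonsingular

  private
    _≈ᵂ_ : NonsingularForm → NonsingularForm → Set (c ⊔ ℓ)
    x ≈ᵂ y = proj₁ x ~ proj₁ y

    _+ᵂ_ _*ᵂ_ : NonsingularForm → NonsingularForm → NonsingularForm
    x +ᵂ y = proj₁ x ++ proj₁ y , All.++⁺ (proj₂ x) (proj₂ y)
    x *ᵂ y = proj₁ x ⊗ proj₁ y , Nonsingular-⊗ (proj₂ x) (proj₂ y)

    -ᵂ_ : NonsingularForm → NonsingularForm
    -ᵂ x = negForm (proj₁ x) , All.gmap⁺ -‿nonzero (proj₂ x)

    0ᵂ 1ᵂ : NonsingularForm
    0ᵂ = [] , []
    1ᵂ = 1# ∷ [] , 1≉0 ∷ []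

    W-isCommutativeRing : IsCommutativeRing _≈ᵂ_ _+ᵂ_ _*ᵂ_ -ᵂ_ 0ᵂ 1ᵂ
    W-isCommutativeRing = record
      { isRing = record
        { +-isAbelianGroup = record
          { isGroup = record
            { isMonoid = record
              { isSemigroup = record
                { isMagma = record
                  { isEquivalence = record { refl = ~-refl ; sym = ~-sym ; trans = ~-trans }
                  ; ∙-cong        = ~-++
                  }
                ; assoc = λ x y z → ≅⇒~ (≅-reflexive (++-assoc (proj₁ x) (proj₁ y) (proj₁ z)))
                }
              ; identity = (λ _ → ~-refl) , (λ x → ≅⇒~ (≅-reflexive (++-identityʳ (proj₁ x))))
              }
            ; inverse = (λ x → ~-trans (≅⇒~ (↭⇒≅ (↭.++-comm (negForm (proj₁ x)) (proj₁ x)))) (++-negForm~[] (proj₂ x)))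
                      , (λ x → ++-negForm~[] (proj₂ x))
            ; ⁻¹-cong = ~-negForm
            }
          ; comm = λ x y → ≅⇒~ (↭⇒≅ (↭.++-comm (proj₁ x) (proj₁ y)))
          }
        ; *-cong = λ {x} {x′} {y} {y′} x~x′ y~y′ → ~-trans (~-⊗ˡ (proj₁ y) (proj₂ y) x~x′) (~-⊗ʳ (proj₁ x′) (proj₂ x′) y~y′)
        ; *-assoc = λ x y z → ≅⇒~ (⊗-assoc (proj₁ x) (proj₁ y) (proj₁ z))
        ; *-identity = (λ x → ≅⇒~ (⊗-identityˡ (proj₁ x)))
                     , (λ x → ≅⇒~ (≅-trans (⊗-comm (proj₁ x) (1# ∷ [])) (⊗-identityˡ (proj₁ x))))
        ; distrib = (λ x y z → ≅⇒~ (≅-trans (⊗-comm (proj₁ x) (proj₁ y ++ proj₁ z))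
                                   (≅-trans (≅-reflexive (⊗-distribʳ-++ (proj₁ y) (proj₁ z) (proj₁ x)))
                                            (≅-++ (⊗-comm (proj₁ y) (proj₁ x)) (⊗-comm (proj₁ z) (proj₁ x))))))
                  , (λ x y z → ≅⇒~ (≅-reflexive (⊗-distribʳ-++ (proj₁ y) (proj₁ z) (proj₁ x))))
        }
      ; *-comm = λ x y → ≅⇒~ (⊗-comm (proj₁ x) (proj₁ y))
      }

  W : CommutativeRing (c ⊔ ℓ) (c ⊔ ℓ)
  W = record { isCommutativeRing = W-isCommutativeRing }

module PfisterElements {c ℓ} (F : Field c ℓ) (2≉0 : Characteristic≢2 F)
                       {I : Set} (b : I → Field.Carrier F) (b≉0 : ∀ i → Nonzero F (b i)) where
  open Field F hiding (zero)
  open Witt F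
  open FormIsometry F
  open WittRing F 2≉0
  module W = CommutativeRing W
  open SubsetExpansion W using (sumᴸ; productᴸ; polynomial; SquareIsDouble)
  open IntegerEmbedding W using (ι)
  open import Algebra.Properties.Semiring.Mult W.semiring using (_×_)
  open import Algebra.Properties.Semiring.Exp W.semiring using () renaming (_^_ to _^ᵂ_)
  open import Algebra.Properties.Ring W.ring using (-‿distribˡ-*; -‿distribʳ-*)

  ⟪_⟫ : I → NonsingularForm
  ⟪ i ⟫ = ⟨1, b i ⟩ , 1≉0 ∷ b≉0 i ∷ []

  ⟪⟫-squareIsDouble : ∀ i → SquareIsDouble ⟪ i ⟫
  ⟪⟫-squareIsDouble i = ≅⇒~ (begin
    1# * 1# ∷ 1# * b i ∷ b i * 1# ∷ b i * b i ∷ []   ≈⟨ ≅-pointwise (*-identityˡ 1# ∷ *-identityˡ (b i) ∷ *-identityʳ (b i) ∷ refl ∷ []) ⟩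
    1# ∷ b i ∷ b i ∷ b i * b i ∷ []                  ≈⟨ ≅-++ʳ (1# ∷ b i ∷ b i ∷ []) (⟨b²⟩≅⟨1⟩ (b≉0 i)) ⟩
    1# ∷ b i ∷ b i ∷ 1# ∷ []                         ≈⟨ ≅-∷ refl (≅-∷ refl (≅-swap (b i) 1# [])) ⟩
    1# ∷ b i ∷ 1# ∷ b i ∷ []                         ∎)
    where open ≅-Reasoning

  proj₁-sumᴸ : ∀ is → proj₁ (sumᴸ (map ⟪_⟫ is)) ≡ concatMap (λ i → ⟨1, b i ⟩) is
  proj₁-sumᴸ []       = ≡.refl
  proj₁-sumᴸ (i ∷ is) = ≡.cong (⟨1, b i ⟩ ++_) (proj₁-sumᴸ is)

  proj₁-productᴸ : ∀ is → proj₁ (productᴸ (map ⟪_⟫ is)) ≡ pfister (map b is)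
  proj₁-productᴸ []       = ≡.refl
  proj₁-productᴸ (i ∷ is) = ≡.cong (⟨1, b i ⟩ ⊗_) (proj₁-productᴸ is)

  ·≈×* : ∀ m (x : NonsingularForm) → m · proj₁ x ~ proj₁ ((m × W.1#) W.* x)
  ·≈×* zero    x = ~-refl
  ·≈×* (suc m) x = ~-++ (≅⇒~ (≅-sym (≅-pointwise (map-≈-id *-identityˡ (proj₁ x))))) (·≈×* m x)

  ℤ·≈ι* : ∀ z (x : NonsingularForm) → z ℤ· proj₁ x ~ proj₁ (ι z W.* x)
  ℤ·≈ι* (+ m)     x = ·≈×* m x
  ℤ·≈ι* -[1+ m ] x = begin
    suc m · negForm (proj₁ x)                  ≈⟨ ·≈×* (suc m) (W.- x) ⟩
    proj₁ ((suc m × W.1#) W.* (W.- x))         ≈⟨ ~-sym (-‿distribʳ-* (suc m × W.1#) x) ⟩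
    proj₁ (W.- ((suc m × W.1#) W.* x))         ≈⟨ -‿distribˡ-* (suc m × W.1#) x ⟩
    proj₁ ((W.- (suc m × W.1#)) W.* x)         ∎
    where open ~-Reasoning

  proj₁-^ : ∀ (x : NonsingularForm) q → proj₁ (x ^ᵂ q) ≡ proj₁ x ^ q
  proj₁-^ x zero    = ≡.refl
  proj₁-^ x (suc q) = ≡.cong (proj₁ x ⊗_) (proj₁-^ x q)

  evalPoly≈polynomial : ∀ f d (x : NonsingularForm) → evalPoly f d (proj₁ x) ~ proj₁ (polynomial (ι ∘ f) (upTo (suc d)) x)
  evalPoly≈polynomial f d x = go (upTo (suc d))
    where
    go : ∀ qs → concatMap (λ q → f q ℤ· (proj₁ x ^ q)) qs ~ proj₁ (polynomial (ι ∘ f) qs x)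
    go []       = ~-refl
    go (q ∷ qs) = ~-++ (≡.subst (λ φ → f q ℤ· φ ~ proj₁ (ι (f q) W.* x ^ᵂ q)) (proj₁-^ x q) (ℤ·≈ι* (f q) (x ^ᵂ q))) (go qs)

module MainArgument {c ℓ} (F : Field c ℓ) (2≉0 : Characteristic≢2 F)
                    (d : ℕ) (f : ℕ → ℤ) (n : ℕ) (n≤d : n ≤ d)
                    (a : Fin d → Field.Carrier F) (a≉0 : ∀ i → Nonzero F (a i)) (τ : Permutation′ d) where
  open Field F hiding (zero)
  open Witt F
  open FormIsometry F
  open WittRing F 2≉0
  open SubsetExpansion W
  open IntegerEmbedding W using (ι)

  τ′ : Fin n → Fin d
  τ′ i = τ ⟨$⟩ʳ inject≤ i n≤d

  open PfisterElements F 2≉0 (a ∘ τ′) (a≉0 ∘ τ′) public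

  τ′-injective : ∀ {i j} → τ′ i ≡ τ′ j → i ≡ j
  τ′-injective eq = Fin.inject≤-injective n≤d n≤d _ _
    (≡.trans (≡.sym (Perm.inverseˡ τ)) (≡.trans (≡.cong (τ Perm.⟨$⟩ˡ_) eq) (Perm.inverseˡ τ)))

  EvaluationsVanish : Set (c ⊔ ℓ)
  EvaluationsVanish = ∀ (k : ℕ) → 1 ≤ k → (k≤n : k ≤ n) → (σ : Permutation′ d) →
    IsZeroW (evalPoly f d (concatMap (λ i → ⟨1, a (σ ⟨$⟩ʳ inject≤ i (≤-trans k≤n n≤d)) ⟩) (allFin k)))

  polynomial-vanishes-at-subsum : f 0 ≡ + 0 → EvaluationsVanish →
    ∀ {T} → T ⊆ allFin n → polynomial (ι ∘ f) (upTo (suc d)) (sumᴸ (map ⟪_⟫ T)) W.≈ W.0#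
  polynomial-vanishes-at-subsum f0≡0 hyp {[]} _ =
    ~-trans (polynomial-at-0 (ι ∘ f) d) (≅⇒~ (≅-reflexive (≡.cong (proj₁ ∘ ι) f0≡0)))
  polynomial-vanishes-at-subsum f0≡0 hyp {T@(_ ∷ _)} T⊆allFin =
    ~-trans (~-sym (evalPoly≈polynomial f d (sumᴸ (map ⟪_⟫ T))))
            (IsZeroW⇒~[] (≡.subst (IsZeroW ∘ evalPoly f d) concatMap≡ (hyp k (s≤s z≤n) k≤n σ)))
    where
    k = length (map τ′ T)
    k≤n : k ≤ n
    k≤n = ≤-trans (ℕ.≤-reflexive (length-map τ′ T))
                  (≤-trans (length-mono-≤ T⊆allFin) (ℕ.≤-reflexive (length-tabulate (λ i → i))))
    extension = extend-Unique (map τ′ T)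
                  (Unique.map⁺ τ′-injective (Unique-resp-⊇ (Unique.allFin⁺ n) T⊆allFin)) (≤-trans k≤n n≤d)
    σ = proj₁ extension
    σ′ : Fin k → Fin d
    σ′ i = σ ⟨$⟩ʳ inject≤ i (≤-trans k≤n n≤d)
    concatMap≡ : concatMap (λ i → ⟨1, a (σ′ i) ⟩) (allFin k) ≡ proj₁ (sumᴸ (map ⟪_⟫ T))
    concatMap≡ = begin
      concatMap (λ i → ⟨1, a (σ′ i) ⟩) (allFin k)       ≡⟨ concatMap-map (λ j → ⟨1, a j ⟩) σ′ (allFin k) ⟨
      concatMap (λ j → ⟨1, a j ⟩) (map σ′ (allFin k))   ≡⟨ ≡.cong (concatMap (λ j → ⟨1, a j ⟩)) (proj₂ extension) ⟩
      concatMap (λ j → ⟨1, a j ⟩) (map τ′ T)            ≡⟨ concatMap-map (λ j → ⟨1, a j ⟩) τ′ T ⟩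
      concatMap (λ i → ⟨1, a (τ′ i) ⟩) T                ≡⟨ proj₁-sumᴸ T ⟨
      proj₁ (sumᴸ (map ⟪_⟫ T))                          ∎
      where open ≡.≡-Reasoning

  pfisterElements : List NonsingularForm
  pfisterElements = map ⟪_⟫ (allFin n)

  weightedCoefficient*pfisterProduct≈0 : f 0 ≡ + 0 → EvaluationsVanish →
    weightedCoefficient (ι ∘ f) (upTo (suc d)) n W.* productᴸ pfisterElements W.≈ W.0#
  weightedCoefficient*pfisterProduct≈0 f0≡0 hyp =
    ≡.subst (λ k → weightedCoefficient (ι ∘ f) (upTo (suc d)) k W.* productᴸ pfisterElements W.≈ W.0#)
            (≡.trans (length-map ⟪_⟫ (allFin n)) (length-tabulate {n = n} (λ i → i)))
            (vanishesOnSubsums⇒weightedCoefficient*product≈0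
              (All.map⁺ (All.universal ⟪⟫-squareIsDouble (allFin n))) (ι ∘ f) (upTo (suc d)) vanishes)
    where
    vanishes : ∀ {ys} → ys ⊆ pfisterElements → polynomial (ι ∘ f) (upTo (suc d)) (sumᴸ ys) W.≈ W.0#
    vanishes ys⊆ with ⊆-map⁻ ⟪_⟫ (allFin n) ys⊆
    ... | T , T⊆allFin , ≡.refl = polynomial-vanishes-at-subsum f0≡0 hyp T⊆allFin

mainTheorem4 : ∀ {c ℓ} (F : Field c ℓ) →
  let open Field F
      open Witt F
  in ¬ (1# + 1# ≈ 0#) →
     (d : ℕ) (f : ℕ → ℤ) → f 0 ≡ + 0 →
     (n : ℕ) (n≤d : n ≤ d) →
     (a : Fin d → Carrier) → (∀ i → ¬ (a i ≈ 0#)) →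
     (∀ (k : ℕ) → 1 ≤ k → (k≤n : k ≤ n) → (σ : Permutation′ d) →
        IsZeroW (evalPoly f d
          (concatMap (λ i → ⟨1, a (σ ⟨$⟩ʳ inject≤ i (≤-trans k≤n n≤d)) ⟩) (allFin k)))) →
     (τ : Permutation′ d) →
     IsZeroW (coefficientSum f n d ℤ· pfister (map (λ i → a (τ ⟨$⟩ʳ inject≤ i n≤d)) (allFin n)))
mainTheorem4 F 2≉0 d f f0≡0 n n≤d a a≉0 hyp τ = ~[]⇒IsZeroW (begin
  cs ℤ· pfister (map (a ∘ τ′) (allFin n))                 ≡⟨ ≡.cong (cs ℤ·_) (proj₁-productᴸ (allFin n)) ⟨
  cs ℤ· proj₁ (productᴸ pfisterElements)                   ≈⟨ ℤ·≈ι* cs (productᴸ pfisterElements) ⟩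
  proj₁ (ι cs W.* productᴸ pfisterElements)                ≈⟨ ~-⊗ˡ _ (proj₂ (productᴸ pfisterElements)) (ι-coefficientSum f n≤d) ⟩
  proj₁ (weightedCoefficient (ι ∘ f) (upTo (suc d)) n W.* productᴸ pfisterElements)
                                                           ≈⟨ weightedCoefficient*pfisterProduct≈0 f0≡0 hyp ⟩
  []                                                       ∎)
  where
  open Witt F using (_ℤ·_; pfister)
  open WittRing F 2≉0 using (~[]⇒IsZeroW; ~-⊗ˡ; module ~-Reasoning)
  open SubsetExpansion (WittRing.W F 2≉0) using (productᴸ; weightedCoefficient)
  open IntegerEmbedding (WittRing.W F 2≉0) using (ι)
  open CoefficientSum (WittRing.W F 2≉0) using (ι-coefficientSum)
  open MainArgument F 2≉0 d f n n≤d a a≉0 τ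
  open ~-Reasoning
  cs = coefficientSum f n d
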